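{- Let $A=(\mathbf a_1,\ldots,\mathbf a_n)\in\mathbb Z^{d\times n}$ be a unimodular configuration with no repeated columns and set $A_0=(A,\mathbf 0)\in\mathbb Z^{d\times(n+1)}$. Let $\mathcal P_A=\mathrm{conv}(\{\mathbf a_1,\dots,\mathbf a_n\})$ and $\mathcal P_{A_0}=\mathrm{conv}(\{\mathbf a_1,\dots,\mathbf a_n,\mathbf 0\})$. Assume that $\mathcal P_{A_0}\cap\mathbb Z^d=\{\mathbf a_1,\ldots,\mathbf a_n,\mathbf 0\}$ and that both $\mathcal P_A$ and $\mathcal P_{A_0}$ are spanning. Then \[h^*(\mathcal P_{A_0}*(-\mathcal P_{A_0}),t)=(1+t)\,h^*(\mathcal P_A*(-\mathcal P_A),t).\]
   Context: A configuration is a matrix whose columns lie on an affine hyperplane not through the origin; an integer matrix of rank $d$ is unimodular if all nonzero maximal minors have the same absolute value. A full-dimensional lattice polytope $\mathcal P\subset\mathbb R^d$ is spanning if $\sum_{\mathbf a\in\mathcal P\cap\mathbb Z^d}\mathbb Z(\mathbf a,1)=\mathbb Z^{d+1}$; in general a lattice polytope is spanning if it is unimodularly equivalent (via an affine lattice-preserving bijection between affine spans) to a full-dimensional spanning polytope. The Cayley sum is $\mathcal P_1*\mathcal P_2=\mathrm{conv}(\{1\}\times\mathcal P_1\cup\{0\}\times\mathcal P_2)$, and $-\mathcal P=\{ -\mathbf a:\mathbf a\in\mathcal P\}$. For a lattice polytope $\mathcal P$ of dimension $e$ (regarded, after unimodular equivalence, as full-dimensional in $\mathbb R^e$), the $h^*$-polynomial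 is defined by $1+\sum_{k\ge1}|k\mathcal P\cap\mathbb Z^e|t^k=h^*(\mathcal P,t)/(1-t)^{e+1}$. -}

module Defs where

open import Data.Nat as ℕ using (ℕ; zero; suc; _≤_)
open import Data.Nat.Combinatorics using (_C_)
open import Data.Integer as ℤ using (ℤ; +_; ∣_∣)
open import Data.Rational as ℚ using (ℚ; 0ℚ; 1ℚ)
open import Data.Fin as Fin using (Fin; zero; suc; toℕ; punchIn; splitAt)
open import Data.Vec using (Vec; _∷_; lookup; tabulate) renaming (map to vmap)
open import Data.List using (List; length) renaming (map to lmap)
open import Data.List.Relation.Unary.All using (All)
open import Data.List.Relation.Unary.Unique.Propositional using (Unique)
open import Data.List.Membership.Propositional using (_∈_)
open import Data.Product using (Σ; ∃; _×_; _,_; proj₁; proj₂)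
open import Data.Sum using (inj₁; inj₂)
open import Relation.Binary.PropositionalEquality using (_≡_)
open import Relation.Nullary using (¬_)

∑ℚ : ∀ {m} → (Fin m → ℚ) → ℚ
∑ℚ {zero}  f = 0ℚ
∑ℚ {suc m} f = f zero ℚ.+ ∑ℚ (λ i → f (suc i))

∑ℤ : ∀ {m} → (Fin m → ℤ) → ℤ
∑ℤ {zero}  f = + 0
∑ℤ {suc m} f = f zero ℤ.+ ∑ℤ (λ i → f (suc i))

sumListℚ : List ℚ → ℚ
sumListℚ = Data.List.foldr ℚ._+_ 0ℚ
  where import Data.List

sumListℤ : List ℤ → ℤ
sumListℤ = Data.List.foldr ℤ._+_ (+ 0)
  where import Data.List

toℚ : ℤ → ℚ
toℚ z = z ℚ./ 1

ℕtoℚ : ℕ → ℚ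
ℕtoℚ k = toℚ (+ k)

-- Matrices: A : Fin d → Fin n → ℤ  (d rows, n columns)

col : ∀ {d n} → (Fin d → Fin n → ℤ) → Fin n → Vec ℤ d
col A i = tabulate (λ j → A j i)

-- columns of A₀ = (A , 0): index zero is the zero column,
-- index (suc i) is the i-th column of A (order of columns is irrelevant here)
col₀ : ∀ {d n} → (Fin d → Fin n → ℤ) → Fin (suc n) → Vec ℤ d
col₀ A zero    = tabulate (λ _ → + 0)
col₀ A (suc i) = col A i

sgn : ℕ → ℤ
sgn zero    = + 1
sgn (suc k) = ℤ.- sgn k

det : (d : ℕ) → (Fin d → Fin d → ℤ) → ℤ
det zero    M = + 1
det (suc d) M =
  ∑ℤ (λ j → sgn (toℕ j) ℤ.* M zero j ℤ.* det d (λ r c → M (suc r) (punchIn j c)))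

minor : ∀ {d n} → (Fin d → Fin n → ℤ) → (Fin d → Fin n) → ℤ
minor {d} A σ = det d (λ r c → A r (σ c))

-- A has rank d and all nonzero maximal minors have the same absolute value
Unimodular : ∀ {d n} → (Fin d → Fin n → ℤ) → Set
Unimodular {d} {n} A =
  (Σ (Fin d → Fin n) λ σ → ¬ minor A σ ≡ + 0) ×
  (∀ (σ τ : Fin d → Fin n) → ¬ minor A σ ≡ + 0 → ¬ minor A τ ≡ + 0 →
     ∣ minor A σ ∣ ≡ ∣ minor A τ ∣)

-- columns lie on an affine hyperplane { x | w·x = c } with w ≠ 0, c ≠ 0
IsConfiguration : ∀ {d n} → (Fin d → Fin n → ℤ) → Set
IsConfiguration {d} {n} A =
  Σ (Fin d → ℚ) λ w → Σ ℚ λ c →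
    (Σ (Fin d) λ j → ¬ w j ≡ 0ℚ) × (¬ c ≡ 0ℚ) ×
    (∀ i → ∑ℚ (λ j → w j ℚ.* toℚ (A j i)) ≡ c)

-- Lattice polytopes conv(S), S : Fin m → Vec ℤ N a finite list of lattice points

InDil : ∀ {m N} → ℕ → (Fin m → Vec ℤ N) → Vec ℤ N → Set
InDil {m} {N} k S x =
  Σ (Fin m → ℚ) λ λs →
    (∀ i → 0ℚ ℚ.≤ λs i) × (∑ℚ λs ≡ ℕtoℚ k) ×
    (∀ (j : Fin N) → ∑ℚ (λ i → λs i ℚ.* toℚ (lookup (S i) j)) ≡ toℚ (lookup x j))

LatPt : ∀ {m N} → (Fin m → Vec ℤ N) → Vec ℤ N → Set
LatPt S x = InDil 1 S x

EhrhartCount : ∀ {m N} → (Fin m → Vec ℤ N) → ℕ → ℕ → Set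
EhrhartCount {m} {N} S k c =
  Σ (List (Vec ℤ N)) λ xs → Unique xs × length xs ≡ c ×
    (∀ x → (x ∈ xs → InDil k S x) × (InDil k S x → x ∈ xs))

IsEhrhartFunction : ∀ {m N} → (Fin m → Vec ℤ N) → (ℕ → ℕ) → Set
IsEhrhartFunction S L = ∀ k → 1 ≤ k → EhrhartCount S k (L k)

AffIndep : ∀ {m N e} → (Fin m → Vec ℤ N) → (Fin e → Fin m) → Set
AffIndep {m} {N} {e} S ι =
  ∀ (μ : Fin e → ℚ) → ∑ℚ μ ≡ 0ℚ →
    (∀ (j : Fin N) → ∑ℚ (λ i → μ i ℚ.* toℚ (lookup (S (ι i)) j)) ≡ 0ℚ) →
    ∀ i → μ i ≡ 0ℚ

HasDim : ∀ {m N} → (Fin m → Vec ℤ N) → ℕ → Set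
HasDim {m} S e =
  (Σ (Fin (suc e) → Fin m) λ ι → AffIndep S ι) ×
  (∀ (ι : Fin (suc (suc e)) → Fin m) → ¬ AffIndep S ι)

hom : ∀ {N} → Vec ℤ N → Vec ℤ (suc N)
hom p = + 1 ∷ p

InQSpan : ∀ {m N} → (Fin m → Vec ℤ N) → Vec ℤ (suc N) → Set
InQSpan {m} {N} S z =
  Σ (List (ℚ × Vec ℤ N)) λ cs → All (λ c → LatPt S (proj₂ c)) cs ×
    (∀ (j : Fin (suc N)) →
       sumListℚ (lmap (λ c → proj₁ c ℚ.* toℚ (lookup (hom (proj₂ c)) j)) cs)
         ≡ toℚ (lookup z j))

InZSpan : ∀ {m N} → (Fin m → Vec ℤ N) → Vec ℤ (suc N) → Set
InZSpan {m} {N} S z =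
  Σ (List (ℤ × Vec ℤ N)) λ cs → All (λ c → LatPt S (proj₂ c)) cs ×
    (∀ (j : Fin (suc N)) →
       sumListℤ (lmap (λ c → proj₁ c ℤ.* lookup (hom (proj₂ c)) j) cs)
         ≡ lookup z j)

-- conv(S) is spanning: the lattice generated by its homogenised lattice points
-- equals ℤ^{N+1} ∩ (their linear span)  (intrinsic form of the definition)
Spanning : ∀ {m N} → (Fin m → Vec ℤ N) → Set
Spanning {m} {N} S = ∀ (z : Vec ℤ (suc N)) → InQSpan S z → InZSpan S z

-- generators of the Cayley sum conv(S) * (-conv(S)) ⊂ ℝ^{1+N}:
-- (1, s) for s ∈ S and (0, -s) for s ∈ S
cayleyNeg : ∀ {m N} → (Fin m → Vec ℤ N) → Fin (m ℕ.+ m) → Vec ℤ (suc N)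
cayleyNeg {m} S i with splitAt m i
... | inj₁ a = + 1 ∷ S a
... | inj₂ b = + 0 ∷ vmap ℤ.-_ (S b)

-- For a polytope of dimension e with Ehrhart values L k (k ≥ 1) and L 0 := 1,
-- h*(t) = (1-t)^{e+1} ∑_k L k t^k, so its i-th coefficient is
-- ∑_{j=0}^{i} (-1)^j C(e+1,j) L(i-j).

Lext : (ℕ → ℕ) → ℕ → ℤ
Lext L zero    = + 1
Lext L (suc k) = + L (suc k)

hstar : ℕ → (ℕ → ℕ) → ℕ → ℤ
hstar e L i =
  ∑ℤ (λ (j : Fin (suc i)) → sgn (toℕ j) ℤ.* (+ (suc e C toℕ j)) ℤ.* Lext L (i ℕ.∸ toℕ j))

onePlusT : (ℕ → ℤ) → ℕ → ℤ
onePlusT g zero    = g zero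
onePlusT g (suc i) = g (suc i) ℤ.+ g i

module Submission where

open import Defs
open import Algebra.Bundles using (CommutativeMonoid)
import Algebra.Properties.CommutativeSemigroup as CommSemigroupProperties
open import Data.Empty using (⊥-elim)
open import Data.Fin as Fin using (Fin; zero; suc; toℕ; punchIn; _↑ˡ_; _↑ʳ_; splitAt)
import Data.Fin.Properties as FinP
open import Data.Integer as ℤ using (ℤ)
import Data.Integer.Properties as ℤP
open import Data.Integer.Tactic.RingSolver using () renaming (solve-∀ to solveℤ)
open import Data.List as List using (List; []; _∷_; _++_; length) renaming (map to lmap)
open import Data.List.Membership.Propositional using (_∈_)
open import Data.List.Membership.Propositional.Properties using (∈-++⁺ˡ; ∈-++⁺ʳ; ∈-++⁻; ∈-map⁺; ∈-map⁻)
open import Data.List.Membership.Propositional.Properties.WithK using (unique∧set⇒bag)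
import Data.List.Properties as ListP
open import Data.List.Relation.Binary.BagAndSetEquality using (∼bag⇒↭)
open import Data.List.Relation.Binary.Permutation.Propositional.Properties using (↭-length)
open import Data.List.Relation.Unary.All using (All; []; _∷_)
import Data.List.Relation.Unary.All.Properties as AllP
open import Data.List.Relation.Unary.AllPairs using ([]; _∷_)
open import Data.List.Relation.Unary.Any using (here)
open import Data.List.Relation.Unary.Unique.Propositional using (Unique)
import Data.List.Relation.Unary.Unique.Propositional.Properties as UniqueP
open import Data.Maybe using (Maybe; just; nothing)
open import Data.Nat as ℕ using (ℕ; zero; suc; z≤n; s≤s)
open import Data.Nat.Combinatorics using (_C_; nCk+nC[k+1]≡[n+1]C[k+1])
import Data.Nat.Properties as ℕP
open import Data.Product using (Σ; Σ-syntax; _×_; _,_; proj₁; proj₂)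
open import Data.Rational as ℚ using (ℚ; 0ℚ; 1ℚ; _+_; _*_; _-_; -_)
import Data.Rational.Properties as ℚP
import Data.Rational.Unnormalised as ℚᵘ
import Data.Rational.Unnormalised.Properties as ℚᵘP
open import Data.Sum using (_⊎_; inj₁; inj₂)
open import Data.Vec using (Vec; _∷_; lookup; tabulate) renaming (map to vmap)
open import Data.Vec.Functional as VecF using (insertAt)
import Data.Vec.Functional.Properties as VecFP
import Data.Vec.Properties as VecP
open import Function using (_∘_)
open import Function.Bundles using (mk⇔)
open import Level using (0ℓ)
open import Relation.Binary.PropositionalEquality
open import Relation.Nullary using (¬_; yes; no; ¬?)
open import Tactic.RingSolver using () renaming (solve-∀ to solve)
open import Tactic.RingSolver.Core.AlmostCommutativeRing using (AlmostCommutativeRing; fromCommutativeRing)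

-- Write G and G₀ for the vertices of P_A * (-P_A) and P_{A₀} * (-P_{A₀}) in ℤ^{1+d}: G₀ adds
-- u = (1, 0) and v = (0, 0) to G, and u = p + q for p = (1, a₁), q = (0, -a₁) in G. If the
-- columns lie on w·x = c, the linear form Ψ(x₀, x) = w·x - 2c·x₀ equals -c·j on j·conv G.
-- Write a lattice point y of k·conv G₀ as α u + β v + (a point of (k - α - β)·conv G).
-- Spanning of P_{A₀} together with P_{A₀} ∩ ℤ^d = {a₁, …, aₙ, 0} makes w·x a multiple of c,
-- which forces β - α ∈ ℤ. Moving the weight min(α, β) from u onto p + q and discarding v shows
-- that y is either a lattice point of j·conv G with j ≤ k, or such a point plus (k - j)·u with
-- j < k, and Ψ separates all these pieces. Hence L₀(k) = T(k) + T(k - 1) for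
-- T(k) = ∑_{j ≤ k} L(j), that is Ehr₀(t) = (1 + t) Ehr(t) / (1 - t). The same Ψ shows
-- dim G₀ = dim G + 1, so multiplying by (1 - t)^{dim G + 2} gives h*₀ = (1 + t) h*.

open ≡-Reasoning

module ℚ+ = CommSemigroupProperties (CommutativeMonoid.commutativeSemigroup ℚP.+-0-commutativeMonoid)

ringℚ : AlmostCommutativeRing 0ℓ 0ℓ
ringℚ = fromCommutativeRing ℚP.+-*-commutativeRing isZero
  where
  isZero : ∀ x → Maybe (0ℚ ≡ x)
  isZero x with x ℚP.≟ 0ℚ
  ... | yes x≡0 = just (sym x≡0)
  ... | no  _   = nothing

*-cancelˡ-≢0 : ∀ {c x y} → ¬ c ≡ 0ℚ → c * x ≡ c * y → x ≡ y
*-cancelˡ-≢0 {c} {x} {y} c≢0 eq = begin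
  x                  ≡⟨ sym (ℚP.*-identityˡ x) ⟩
  1ℚ * x             ≡⟨ cong (_* x) (sym (ℚP.*-inverseˡ c)) ⟩
  (ℚ.1/ c) * c * x   ≡⟨ ℚP.*-assoc (ℚ.1/ c) c x ⟩
  (ℚ.1/ c) * (c * x) ≡⟨ cong ((ℚ.1/ c) *_) eq ⟩
  (ℚ.1/ c) * (c * y) ≡⟨ sym (ℚP.*-assoc (ℚ.1/ c) c y) ⟩
  (ℚ.1/ c) * c * y   ≡⟨ cong (_* y) (ℚP.*-inverseˡ c) ⟩
  1ℚ * y             ≡⟨ ℚP.*-identityˡ y ⟩
  y                  ∎
  where instance _ = ℚ.≢-nonZero c≢0

private
  toℚᵘ-toℚ : ∀ z → ℚ.toℚᵘ (toℚ z) ℚᵘ.≃ ℚᵘ.mkℚᵘ z 0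
  toℚᵘ-toℚ z = ℚP.toℚᵘ-fromℚᵘ (ℚᵘ.mkℚᵘ z 0)

toℚ-homo-+ : ∀ a b → toℚ (a ℤ.+ b) ≡ toℚ a + toℚ b
toℚ-homo-+ a b = ℚP.toℚᵘ-injective (ℚᵘP.≃-trans (toℚᵘ-toℚ (a ℤ.+ b))
  (ℚᵘP.≃-trans (ℚᵘ.*≡* (cross-multiplied a b))
    (ℚᵘP.≃-sym (ℚᵘP.≃-trans (ℚP.toℚᵘ-homo-+ (toℚ a) (toℚ b))
      (ℚᵘP.+-cong (toℚᵘ-toℚ a) (toℚᵘ-toℚ b))))))
  where
  cross-multiplied : ∀ a b → (a ℤ.+ b) ℤ.* ℤ.+ 1 ≡ (a ℤ.* ℤ.+ 1 ℤ.+ b ℤ.* ℤ.+ 1) ℤ.* ℤ.+ 1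
  cross-multiplied = solveℤ

toℚ-homo-* : ∀ a b → toℚ (a ℤ.* b) ≡ toℚ a * toℚ b
toℚ-homo-* a b = ℚP.toℚᵘ-injective (ℚᵘP.≃-trans (toℚᵘ-toℚ (a ℤ.* b))
  (ℚᵘP.≃-trans (ℚᵘ.*≡* refl)
    (ℚᵘP.≃-sym (ℚᵘP.≃-trans (ℚP.toℚᵘ-homo-* (toℚ a) (toℚ b))
      (ℚᵘP.*-cong (toℚᵘ-toℚ a) (toℚᵘ-toℚ b))))))

toℚ-homo‿- : ∀ a → toℚ (ℤ.- a) ≡ - toℚ a
toℚ-homo‿- a = ℚP.toℚᵘ-injective (ℚᵘP.≃-trans (toℚᵘ-toℚ (ℤ.- a))
  (ℚᵘP.≃-sym (ℚᵘP.≃-trans (ℚP.toℚᵘ-homo‿- (toℚ a)) (ℚᵘP.-‿cong (toℚᵘ-toℚ a)))))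

toℚ-injective : ∀ {a b} → toℚ a ≡ toℚ b → a ≡ b
toℚ-injective {a} {b} eq
  with ℚᵘP.≃-trans (ℚᵘP.≃-sym (toℚᵘ-toℚ a))
         (ℚᵘP.≃-trans (ℚᵘP.≃-reflexive (cong ℚ.toℚᵘ eq)) (toℚᵘ-toℚ b))
... | ℚᵘ.*≡* a*1≡b*1 = trans (sym (ℤP.*-identityʳ a)) (trans a*1≡b*1 (ℤP.*-identityʳ b))

toℚ-mono-≤ : ∀ {a b} → a ℤ.≤ b → toℚ a ℚ.≤ toℚ b
toℚ-mono-≤ {a} {b} a≤b = ℚP.toℚᵘ-cancel-≤
  (ℚᵘP.≤-respˡ-≃ (ℚᵘP.≃-sym (toℚᵘ-toℚ a)) (ℚᵘP.≤-respʳ-≃ (ℚᵘP.≃-sym (toℚᵘ-toℚ b))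
    (ℚᵘ.*≤* (subst₂ ℤ._≤_ (sym (ℤP.*-identityʳ a)) (sym (ℤP.*-identityʳ b)) a≤b))))

toℚ-cancel-≤ : ∀ {a b} → toℚ a ℚ.≤ toℚ b → a ℤ.≤ b
toℚ-cancel-≤ {a} {b} le
  with ℚᵘP.≤-respˡ-≃ (toℚᵘ-toℚ a) (ℚᵘP.≤-respʳ-≃ (toℚᵘ-toℚ b) (ℚP.toℚᵘ-mono-≤ le))
... | ℚᵘ.*≤* a*1≤b*1 = subst₂ ℤ._≤_ (ℤP.*-identityʳ a) (ℤP.*-identityʳ b) a*1≤b*1

ℕtoℚ-homo-+ : ∀ a b → ℕtoℚ (a ℕ.+ b) ≡ ℕtoℚ a + ℕtoℚ b
ℕtoℚ-homo-+ a b = toℚ-homo-+ (ℤ.+ a) (ℤ.+ b)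

ℕtoℚ-nonNeg : ∀ a → 0ℚ ℚ.≤ ℕtoℚ a
ℕtoℚ-nonNeg a = toℚ-mono-≤ {ℤ.+ 0} {ℤ.+ a} (ℤ.+≤+ z≤n)

ℕtoℚ-cancel-≤ : ∀ {a b} → ℕtoℚ a ℚ.≤ ℕtoℚ b → a ℕ.≤ b
ℕtoℚ-cancel-≤ le = ℤP.drop‿+≤+ (toℚ-cancel-≤ le)

ℕtoℚ-m∸n+n : ∀ {m n} → n ℕ.≤ m → ℕtoℚ (m ℕ.∸ n) + ℕtoℚ n ≡ ℕtoℚ m
ℕtoℚ-m∸n+n {m} {n} n≤m = trans (sym (ℕtoℚ-homo-+ (m ℕ.∸ n) n)) (cong ℕtoℚ (ℕP.m∸n+n≡m n≤m))

ℕtoℚ-∸ : ∀ {k r} x → 0ℚ ℚ.≤ x → x ≡ ℕtoℚ k - ℕtoℚ r → r ℕ.≤ k × x ≡ ℕtoℚ (k ℕ.∸ r)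
ℕtoℚ-∸ {k} {r} x x≥0 x≡k-r = r≤k , trans x≡k-r (sym k∸r≡k-r)
  where
  cancel : ∀ a b → b + (a - b) ≡ a
  cancel = solve ringℚ
  isolate : ∀ a b → a ≡ (a + b) - b
  isolate = solve ringℚ
  r≤k : r ℕ.≤ k
  r≤k = ℕtoℚ-cancel-≤ (ℚP.≤-trans (ℚP.≤-reflexive (sym (ℚP.+-identityʳ (ℕtoℚ r))))
                        (ℚP.≤-trans (ℚP.+-monoʳ-≤ (ℕtoℚ r) (subst (0ℚ ℚ.≤_) x≡k-r x≥0))
                          (ℚP.≤-reflexive (cancel (ℕtoℚ k) (ℕtoℚ r)))))
  k∸r≡k-r : ℕtoℚ (k ℕ.∸ r) ≡ ℕtoℚ k - ℕtoℚ r
  k∸r≡k-r = trans (isolate (ℕtoℚ (k ℕ.∸ r)) (ℕtoℚ r)) (cong (_- ℕtoℚ r) (ℕtoℚ-m∸n+n r≤k))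

pt : ∀ {N} → Vec ℤ N → Fin N → ℚ
pt x j = toℚ (lookup x j)

∑ℚ-cong : ∀ {m} {f g : Fin m → ℚ} → (∀ i → f i ≡ g i) → ∑ℚ f ≡ ∑ℚ g
∑ℚ-cong {zero}  f≗g = refl
∑ℚ-cong {suc m} f≗g = cong₂ _+_ (f≗g zero) (∑ℚ-cong (f≗g ∘ suc))

∑ℚ-zero : ∀ m → ∑ℚ {m} (λ _ → 0ℚ) ≡ 0ℚ
∑ℚ-zero zero    = refl
∑ℚ-zero (suc m) = trans (ℚP.+-identityˡ _) (∑ℚ-zero m)

∑ℚ-distrib-+ : ∀ {m} (f g : Fin m → ℚ) → ∑ℚ (λ i → f i + g i) ≡ ∑ℚ f + ∑ℚ g
∑ℚ-distrib-+ {zero}  f g = refl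
∑ℚ-distrib-+ {suc m} f g = begin
  (f zero + g zero) + ∑ℚ (λ i → f (suc i) + g (suc i))
    ≡⟨ cong ((f zero + g zero) +_) (∑ℚ-distrib-+ (f ∘ suc) (g ∘ suc)) ⟩
  (f zero + g zero) + (∑ℚ (f ∘ suc) + ∑ℚ (g ∘ suc))
    ≡⟨ ℚ+.interchange (f zero) (g zero) _ _ ⟩
  (f zero + ∑ℚ (f ∘ suc)) + (g zero + ∑ℚ (g ∘ suc)) ∎

∑ℚ-*ˡ : ∀ {m} (c : ℚ) (f : Fin m → ℚ) → ∑ℚ (λ i → c * f i) ≡ c * ∑ℚ f
∑ℚ-*ˡ {zero}  c f = sym (ℚP.*-zeroʳ c)
∑ℚ-*ˡ {suc m} c f = trans (cong (c * f zero +_) (∑ℚ-*ˡ c (f ∘ suc)))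
                          (sym (ℚP.*-distribˡ-+ c (f zero) (∑ℚ (f ∘ suc))))

∑ℚ-*ʳ : ∀ {m} (c : ℚ) (f : Fin m → ℚ) → ∑ℚ (λ i → f i * c) ≡ ∑ℚ f * c
∑ℚ-*ʳ c f = trans (∑ℚ-cong (λ i → ℚP.*-comm (f i) c)) (trans (∑ℚ-*ˡ c f) (ℚP.*-comm c _))

∑ℚ-neg : ∀ {m} (f : Fin m → ℚ) → ∑ℚ (λ i → - f i) ≡ - ∑ℚ f
∑ℚ-neg {zero}  f = refl
∑ℚ-neg {suc m} f = trans (cong (- f zero +_) (∑ℚ-neg (f ∘ suc)))
                         (sym (ℚP.neg-distrib-+ (f zero) (∑ℚ (f ∘ suc))))

∑ℚ-comm : ∀ {m k} (f : Fin m → Fin k → ℚ) →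
          ∑ℚ (λ i → ∑ℚ (λ j → f i j)) ≡ ∑ℚ (λ j → ∑ℚ (λ i → f i j))
∑ℚ-comm {zero}  {k} f = sym (∑ℚ-zero k)
∑ℚ-comm {suc m} {k} f = trans (cong (∑ℚ (f zero) +_) (∑ℚ-comm (f ∘ suc)))
                              (sym (∑ℚ-distrib-+ (f zero) (λ j → ∑ℚ (λ i → f (suc i) j))))

∑ℚ-*-∑ℚ : ∀ {a k} (μ : Fin a → ℚ) (R : Fin a → Fin k → ℚ) (P : Fin k → ℚ) →
          ∑ℚ (λ i → μ i * ∑ℚ (λ t → R i t * P t)) ≡ ∑ℚ (λ t → ∑ℚ (λ i → μ i * R i t) * P t)
∑ℚ-*-∑ℚ μ R P = begin
  ∑ℚ (λ i → μ i * ∑ℚ (λ t → R i t * P t))    ≡⟨ ∑ℚ-cong (λ i → sym (∑ℚ-*ˡ (μ i) (λ t → R i t * P t))) ⟩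
  ∑ℚ (λ i → ∑ℚ (λ t → μ i * (R i t * P t)))  ≡⟨ ∑ℚ-comm (λ i t → μ i * (R i t * P t)) ⟩
  ∑ℚ (λ t → ∑ℚ (λ i → μ i * (R i t * P t)))
    ≡⟨ ∑ℚ-cong (λ t → trans (∑ℚ-cong (λ i → sym (ℚP.*-assoc (μ i) (R i t) (P t))))
                            (∑ℚ-*ʳ (P t) (λ i → μ i * R i t))) ⟩
  ∑ℚ (λ t → ∑ℚ (λ i → μ i * R i t) * P t)    ∎

∑ℚ-distrib-- : ∀ {m} (f g : Fin m → ℚ) → ∑ℚ (λ i → f i - g i) ≡ ∑ℚ f - ∑ℚ g
∑ℚ-distrib-- f g = trans (∑ℚ-distrib-+ f (λ i → - g i)) (cong (∑ℚ f +_) (∑ℚ-neg g))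

∑ℚ-linear : ∀ {m k} (w : Fin k → ℚ) (λs : Fin m → ℚ) (X : Fin m → Fin k → ℚ) →
            ∑ℚ (λ j → w j * ∑ℚ (λ i → λs i * X i j)) ≡ ∑ℚ (λ i → λs i * ∑ℚ (λ j → w j * X i j))
∑ℚ-linear w λs X = begin
  ∑ℚ (λ j → w j * ∑ℚ (λ i → λs i * X i j))   ≡⟨ ∑ℚ-cong (λ j → sym (∑ℚ-*ˡ (w j) (λ i → λs i * X i j))) ⟩
  ∑ℚ (λ j → ∑ℚ (λ i → w j * (λs i * X i j))) ≡⟨ ∑ℚ-comm (λ j i → w j * (λs i * X i j)) ⟩
  ∑ℚ (λ i → ∑ℚ (λ j → w j * (λs i * X i j))) ≡⟨ ∑ℚ-cong (λ i → trans (∑ℚ-cong (λ j → swap (w j) (λs i) (X i j)))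
                                                                    (∑ℚ-*ˡ (λs i) (λ j → w j * X i j))) ⟩
  ∑ℚ (λ i → λs i * ∑ℚ (λ j → w j * X i j))   ∎
  where
  swap : ∀ a b x → a * (b * x) ≡ b * (a * x)
  swap a b x = trans (sym (ℚP.*-assoc a b x)) (trans (cong (_* x) (ℚP.*-comm a b)) (ℚP.*-assoc b a x))

∑ℚ-punchIn : ∀ {m} (p : Fin (suc m)) (f : Fin (suc m) → ℚ) → ∑ℚ f ≡ f p + ∑ℚ (f ∘ punchIn p)
∑ℚ-punchIn zero f = refl
∑ℚ-punchIn {suc m} (suc p) f = begin
  f zero + ∑ℚ (f ∘ suc)                          ≡⟨ cong (f zero +_) (∑ℚ-punchIn p (f ∘ suc)) ⟩
  f zero + (f (suc p) + ∑ℚ (f ∘ suc ∘ punchIn p)) ≡⟨ ℚ+.x∙yz≈y∙xz (f zero) (f (suc p)) _ ⟩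
  f (suc p) + (f zero + ∑ℚ (f ∘ suc ∘ punchIn p)) ∎

∑ℚ-splitAt : ∀ {m k} (f : Fin (m ℕ.+ k) → ℚ) →
             ∑ℚ f ≡ ∑ℚ (λ i → f (i ↑ˡ k)) + ∑ℚ (λ j → f (m ↑ʳ j))
∑ℚ-splitAt {zero}      f = sym (ℚP.+-identityˡ _)
∑ℚ-splitAt {suc m} {k} f = trans (cong (f zero +_) (∑ℚ-splitAt {m} {k} (f ∘ suc)))
                                 (sym (ℚP.+-assoc (f zero) _ _))

∑ℚ-nonNeg : ∀ {m} (f : Fin m → ℚ) → (∀ i → 0ℚ ℚ.≤ f i) → 0ℚ ℚ.≤ ∑ℚ f
∑ℚ-nonNeg {zero}  f f≥0 = ℚP.≤-refl
∑ℚ-nonNeg {suc m} f f≥0 = ℚP.+-mono-≤ (f≥0 zero) (∑ℚ-nonNeg (f ∘ suc) (f≥0 ∘ suc))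

nonNeg+nonNeg≡0⇒≡0 : ∀ {a b} → 0ℚ ℚ.≤ a → 0ℚ ℚ.≤ b → a + b ≡ 0ℚ → a ≡ 0ℚ
nonNeg+nonNeg≡0⇒≡0 {a} {b} a≥0 b≥0 a+b≡0 = ℚP.≤-antisym a≤0 a≥0
  where
  a≤0 : a ℚ.≤ 0ℚ
  a≤0 = ℚP.≤-trans (ℚP.≤-reflexive (sym (ℚP.+-identityʳ a)))
          (ℚP.≤-trans (ℚP.+-monoʳ-≤ a b≥0) (ℚP.≤-reflexive a+b≡0))

∑ℚ-nonNeg-≡0 : ∀ {m} (f : Fin m → ℚ) → (∀ i → 0ℚ ℚ.≤ f i) → ∑ℚ f ≡ 0ℚ → ∀ i → f i ≡ 0ℚ
∑ℚ-nonNeg-≡0 {suc m} f f≥0 ∑≡0 zero =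
  nonNeg+nonNeg≡0⇒≡0 (f≥0 zero) (∑ℚ-nonNeg (f ∘ suc) (f≥0 ∘ suc)) ∑≡0
∑ℚ-nonNeg-≡0 {suc m} f f≥0 ∑≡0 (suc i) =
  ∑ℚ-nonNeg-≡0 (f ∘ suc) (f≥0 ∘ suc)
    (nonNeg+nonNeg≡0⇒≡0 (∑ℚ-nonNeg (f ∘ suc) (f≥0 ∘ suc)) (f≥0 zero)
      (trans (ℚP.+-comm _ (f zero)) ∑≡0)) i

δ : ∀ {m} → Fin m → Fin m → ℚ
δ a i with a Fin.≟ i
... | yes _ = 1ℚ
... | no  _ = 0ℚ

δ-diag : ∀ {m} (a : Fin m) → δ a a ≡ 1ℚ
δ-diag a with a Fin.≟ a
... | yes _   = refl
... | no  a≢a = ⊥-elim (a≢a refl)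

δ-off : ∀ {m} (a i : Fin m) → ¬ a ≡ i → δ a i ≡ 0ℚ
δ-off a i a≢i with a Fin.≟ i
... | yes a≡i = ⊥-elim (a≢i a≡i)
... | no  _   = refl

δ-nonNeg : ∀ {m} (a i : Fin m) → 0ℚ ℚ.≤ δ a i
δ-nonNeg a i with a Fin.≟ i
... | yes _ = ℚP.nonNegative⁻¹ 1ℚ
... | no  _ = ℚP.≤-refl

∑ℚ-δ-* : ∀ {m} (a : Fin (suc m)) (f : Fin (suc m) → ℚ) → ∑ℚ (λ i → δ a i * f i) ≡ f a
∑ℚ-δ-* {m} a f = begin
  ∑ℚ (λ i → δ a i * f i)                                         ≡⟨ ∑ℚ-punchIn a (λ i → δ a i * f i) ⟩
  δ a a * f a + ∑ℚ (λ i → δ a (punchIn a i) * f (punchIn a i))  ≡⟨ cong₂ _+_ (cong (_* f a) (δ-diag a))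
                                                                     (trans (∑ℚ-cong off) (∑ℚ-zero m)) ⟩
  1ℚ * f a + 0ℚ                                                  ≡⟨ trans (ℚP.+-identityʳ _) (ℚP.*-identityˡ _) ⟩
  f a                                                            ∎
  where
  off : ∀ i → δ a (punchIn a i) * f (punchIn a i) ≡ 0ℚ
  off i = trans (cong (_* f (punchIn a i)) (δ-off a (punchIn a i) (FinP.punchInᵢ≢i a i ∘ sym)))
                (ℚP.*-zeroˡ (f (punchIn a i)))

∑ℚ-δ : ∀ {m} (a : Fin (suc m)) → ∑ℚ (δ a) ≡ 1ℚ
∑ℚ-δ a = trans (∑ℚ-cong (λ i → sym (ℚP.*-identityʳ (δ a i)))) (∑ℚ-δ-* a (λ _ → 1ℚ))

module ℤ+ = CommSemigroupProperties (CommutativeMonoid.commutativeSemigroup ℤP.+-0-commutativeMonoid)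

∑ℤ-cong : ∀ {m} {f g : Fin m → ℤ} → (∀ i → f i ≡ g i) → ∑ℤ f ≡ ∑ℤ g
∑ℤ-cong {zero}  f≗g = refl
∑ℤ-cong {suc m} f≗g = cong₂ ℤ._+_ (f≗g zero) (∑ℤ-cong (f≗g ∘ suc))

∑ℤ-zero : ∀ m → ∑ℤ {m} (λ _ → ℤ.+ 0) ≡ ℤ.+ 0
∑ℤ-zero zero    = refl
∑ℤ-zero (suc m) = trans (ℤP.+-identityˡ _) (∑ℤ-zero m)

∑ℤ-distrib-+ : ∀ {m} (f g : Fin m → ℤ) → ∑ℤ (λ i → f i ℤ.+ g i) ≡ ∑ℤ f ℤ.+ ∑ℤ g
∑ℤ-distrib-+ {zero}  f g = refl
∑ℤ-distrib-+ {suc m} f g =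
  trans (cong (λ rest → (f zero ℤ.+ g zero) ℤ.+ rest) (∑ℤ-distrib-+ (f ∘ suc) (g ∘ suc)))
        (ℤ+.interchange (f zero) (g zero) (∑ℤ (f ∘ suc)) (∑ℤ (g ∘ suc)))

∑ℤ-neg : ∀ {m} (f : Fin m → ℤ) → ∑ℤ (λ i → ℤ.- f i) ≡ ℤ.- ∑ℤ f
∑ℤ-neg {zero}  f = refl
∑ℤ-neg {suc m} f = trans (cong (λ rest → ℤ.- f zero ℤ.+ rest) (∑ℤ-neg (f ∘ suc)))
                         (sym (ℤP.neg-distrib-+ (f zero) (∑ℤ (f ∘ suc))))

-- Sequences ℕ → ℤ are coefficient sequences of power series; oneMinusT g is (1 - t) g(t).

oneMinusT : (ℕ → ℤ) → ℕ → ℤ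
oneMinusT g zero    = g zero
oneMinusT g (suc i) = g (suc i) ℤ.- g i

oneMinusT^ : ℕ → (ℕ → ℤ) → ℕ → ℤ
oneMinusT^ zero    g = g
oneMinusT^ (suc m) g = oneMinusT (oneMinusT^ m g)

binomialSum : ℕ → (ℕ → ℤ) → ℕ → ℤ
binomialSum m g i =
  ∑ℤ (λ (j : Fin (suc i)) → sgn (toℕ j) ℤ.* ℤ.+ (m C toℕ j) ℤ.* g (i ℕ.∸ toℕ j))

binomialSum-zero : ∀ g i → binomialSum 0 g i ≡ g i
binomialSum-zero g i = begin
  ℤ.+ 1 ℤ.* ℤ.+ 1 ℤ.* g i ℤ.+ ∑ℤ (λ (j : Fin i) → t j)
    ≡⟨ cong₂ ℤ._+_ (ℤP.*-identityˡ (g i)) (trans (∑ℤ-cong vanish) (∑ℤ-zero i)) ⟩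
  g i ℤ.+ ℤ.+ 0 ≡⟨ ℤP.+-identityʳ (g i) ⟩
  g i           ∎
  where
  t : Fin i → ℤ
  t j = sgn (suc (toℕ j)) ℤ.* ℤ.+ (0 C suc (toℕ j)) ℤ.* g (i ℕ.∸ suc (toℕ j))
  vanish : ∀ j → t j ≡ ℤ.+ 0
  vanish j = trans (cong (ℤ._* g (i ℕ.∸ suc (toℕ j))) (ℤP.*-zeroʳ (sgn (suc (toℕ j)))))
                   (ℤP.*-zeroˡ (g (i ℕ.∸ suc (toℕ j))))

-- Pascal: C(m+1, j+1) = C(m, j) + C(m, j+1) splits every term but the first.
binomialSum-suc : ∀ m g i →
  binomialSum (suc m) g (suc i) ≡ binomialSum m g (suc i) ℤ.- binomialSum m g i
binomialSum-suc m g i = begin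
  g₀ ℤ.+ ∑ℤ (λ j → s j ℤ.* ℤ.+ (suc m C suc (toℕ j)) ℤ.* h j)
    ≡⟨ cong (λ rest → g₀ ℤ.+ rest) (∑ℤ-cong pascal) ⟩
  g₀ ℤ.+ ∑ℤ (λ j → ℤ.- old j ℤ.+ new j)
    ≡⟨ cong (λ rest → g₀ ℤ.+ rest) (trans (∑ℤ-distrib-+ (λ j → ℤ.- old j) new)
                             (cong (ℤ._+ ∑ℤ new) (∑ℤ-neg old))) ⟩
  g₀ ℤ.+ (ℤ.- binomialSum m g i ℤ.+ ∑ℤ new)
    ≡⟨ rearrange g₀ (binomialSum m g i) (∑ℤ new) ⟩
  (g₀ ℤ.+ ∑ℤ new) ℤ.- binomialSum m g i ∎
  where
  g₀ = ℤ.+ 1 ℤ.* ℤ.+ 1 ℤ.* g (suc i)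
  s : Fin (suc i) → ℤ
  s j = sgn (suc (toℕ j))
  h : Fin (suc i) → ℤ
  h j = g (i ℕ.∸ toℕ j)
  old new : Fin (suc i) → ℤ
  old j = sgn (toℕ j) ℤ.* ℤ.+ (m C toℕ j) ℤ.* h j
  new j = s j ℤ.* ℤ.+ (m C suc (toℕ j)) ℤ.* h j
  split : ∀ a x y b → ℤ.- a ℤ.* (x ℤ.+ y) ℤ.* b ≡ ℤ.- (a ℤ.* x ℤ.* b) ℤ.+ ℤ.- a ℤ.* y ℤ.* b
  split = solveℤ
  pascal : ∀ j → s j ℤ.* ℤ.+ (suc m C suc (toℕ j)) ℤ.* h j ≡ ℤ.- old j ℤ.+ new j
  pascal j = trans (cong (λ x → s j ℤ.* ℤ.+ x ℤ.* h j) (sym (nCk+nC[k+1]≡[n+1]C[k+1] m (toℕ j))))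
                   (split (sgn (toℕ j)) (ℤ.+ (m C toℕ j)) (ℤ.+ (m C suc (toℕ j))) (h j))
  rearrange : ∀ a b c → a ℤ.+ (ℤ.- b ℤ.+ c) ≡ (a ℤ.+ c) ℤ.- b
  rearrange = solveℤ

binomialSum≡oneMinusT^ : ∀ m g i → binomialSum m g i ≡ oneMinusT^ m g i
binomialSum≡oneMinusT^ zero    g i       = binomialSum-zero g i
binomialSum≡oneMinusT^ (suc m) g zero    = binomialSum≡oneMinusT^ m g zero
binomialSum≡oneMinusT^ (suc m) g (suc i) =
  trans (binomialSum-suc m g i)
        (cong₂ ℤ._-_ (binomialSum≡oneMinusT^ m g (suc i)) (binomialSum≡oneMinusT^ m g i))

oneMinusT-cong : ∀ {f g} → (∀ i → f i ≡ g i) → ∀ i → oneMinusT f i ≡ oneMinusT g i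
oneMinusT-cong f≗g zero    = f≗g zero
oneMinusT-cong f≗g (suc i) = cong₂ ℤ._-_ (f≗g (suc i)) (f≗g i)

oneMinusT^-cong : ∀ m {f g} → (∀ i → f i ≡ g i) → ∀ i → oneMinusT^ m f i ≡ oneMinusT^ m g i
oneMinusT^-cong zero    f≗g = f≗g
oneMinusT^-cong (suc m) f≗g = oneMinusT-cong (oneMinusT^-cong m f≗g)

onePlusT-cong : ∀ {f g} → (∀ i → f i ≡ g i) → ∀ i → onePlusT f i ≡ onePlusT g i
onePlusT-cong f≗g zero    = f≗g zero
onePlusT-cong f≗g (suc i) = cong₂ ℤ._+_ (f≗g (suc i)) (f≗g i)

oneMinusT-onePlusT : ∀ g i → oneMinusT (onePlusT g) i ≡ onePlusT (oneMinusT g) i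
oneMinusT-onePlusT g zero          = refl
oneMinusT-onePlusT g (suc zero)    = telescope (g 1) (g 0)
  where
  telescope : ∀ a b → (a ℤ.+ b) ℤ.- b ≡ (a ℤ.- b) ℤ.+ b
  telescope = solveℤ
oneMinusT-onePlusT g (suc (suc i)) = telescope (g (suc (suc i))) (g (suc i)) (g i)
  where
  telescope : ∀ a b c → (a ℤ.+ b) ℤ.- (b ℤ.+ c) ≡ (a ℤ.- b) ℤ.+ (b ℤ.- c)
  telescope = solveℤ

oneMinusT^-onePlusT : ∀ m g i → oneMinusT^ m (onePlusT g) i ≡ onePlusT (oneMinusT^ m g) i
oneMinusT^-onePlusT zero    g i = refl
oneMinusT^-onePlusT (suc m) g i =
  trans (oneMinusT-cong (oneMinusT^-onePlusT m g) i) (oneMinusT-onePlusT (oneMinusT^ m g) i)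

oneMinusT^-oneMinusT : ∀ m g i → oneMinusT^ m (oneMinusT g) i ≡ oneMinusT^ (suc m) g i
oneMinusT^-oneMinusT zero    g i = refl
oneMinusT^-oneMinusT (suc m) g i = oneMinusT-cong (oneMinusT^-oneMinusT m g) i

-- cumulative L k = Lext L 0 + ⋯ + Lext L k, the coefficients of Ehr(t) / (1 - t).
cumulative : (ℕ → ℕ) → ℕ → ℕ
cumulative L zero    = 1
cumulative L (suc k) = cumulative L k ℕ.+ L (suc k)

Lext≡oneMinusT-cumulative : ∀ L k → Lext L k ≡ oneMinusT (ℤ.+_ ∘ cumulative L) k
Lext≡oneMinusT-cumulative L zero    = refl
Lext≡oneMinusT-cumulative L (suc k) =
  sym (trans (cong (ℤ._- ℤ.+ cumulative L k) (ℤP.pos-+ (cumulative L k) (L (suc k))))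
             (cancel (ℤ.+ cumulative L k) (ℤ.+ L (suc k))))
  where
  cancel : ∀ a b → (a ℤ.+ b) ℤ.- a ≡ b
  cancel = solveℤ

hstar-onePlusT : ∀ e L₀ L → (∀ k → L₀ (suc k) ≡ cumulative L (suc k) ℕ.+ cumulative L k) →
                 ∀ i → hstar (suc e) L₀ i ≡ onePlusT (hstar e L) i
hstar-onePlusT e L₀ L L₀≡ i = begin
  hstar (suc e) L₀ i                           ≡⟨ binomialSum≡oneMinusT^ (suc (suc e)) (Lext L₀) i ⟩
  oneMinusT^ (suc (suc e)) (Lext L₀) i         ≡⟨ oneMinusT^-cong (suc (suc e)) Lext-L₀ i ⟩
  oneMinusT^ (suc (suc e)) (onePlusT T) i      ≡⟨ oneMinusT^-onePlusT (suc (suc e)) T i ⟩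
  onePlusT (oneMinusT^ (suc (suc e)) T) i      ≡⟨ onePlusT-cong (λ j → sym (hstar-L j)) i ⟩
  onePlusT (hstar e L) i                       ∎
  where
  T : ℕ → ℤ
  T = ℤ.+_ ∘ cumulative L
  Lext-L₀ : ∀ k → Lext L₀ k ≡ onePlusT T k
  Lext-L₀ zero    = refl
  Lext-L₀ (suc k) = trans (cong ℤ.+_ (L₀≡ k)) (ℤP.pos-+ (cumulative L (suc k)) (cumulative L k))
  hstar-L : ∀ j → hstar e L j ≡ oneMinusT^ (suc (suc e)) T j
  hstar-L j = begin
    hstar e L j                          ≡⟨ binomialSum≡oneMinusT^ (suc e) (Lext L) j ⟩
    oneMinusT^ (suc e) (Lext L) j        ≡⟨ oneMinusT^-cong (suc e) (Lext≡oneMinusT-cumulative L) j ⟩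
    oneMinusT^ (suc e) (oneMinusT T) j   ≡⟨ oneMinusT^-oneMinusT (suc e) T j ⟩
    oneMinusT^ (suc (suc e)) T j         ∎

LinIndep : ∀ {a k} → (Fin a → Fin k → ℚ) → Set
LinIndep {a} {k} v = ∀ (μ : Fin a → ℚ) → (∀ t → ∑ℚ (λ i → μ i * v i t) ≡ 0ℚ) → ∀ i → μ i ≡ 0ℚ

LinIndep-dropZeroColumn : ∀ {a k} (v : Fin (suc a) → Fin (suc k) → ℚ) → (∀ i → v i zero ≡ 0ℚ) →
                          LinIndep v → LinIndep (λ i t → v (suc i) (suc t))
LinIndep-dropZeroColumn {a = a} v column≡0 indep μ′ comb≡0 i = indep (0ℚ VecF.∷ μ′) comb≡0′ (suc i)
  where
  rest≡0 : ∀ t → ∑ℚ (λ i → μ′ i * v (suc i) t) ≡ 0ℚ → 0ℚ * v zero t + ∑ℚ (λ i → μ′ i * v (suc i) t) ≡ 0ℚ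
  rest≡0 t eq = trans (cong₂ _+_ (ℚP.*-zeroˡ (v zero t)) eq) (ℚP.+-identityˡ 0ℚ)
  comb≡0′ : ∀ t → ∑ℚ (λ i → (0ℚ VecF.∷ μ′) i * v i t) ≡ 0ℚ
  comb≡0′ zero    = rest≡0 zero (trans (∑ℚ-cong (λ i → trans (cong (μ′ i *_) (column≡0 (suc i)))
                                                                (ℚP.*-zeroʳ (μ′ i))))
                                       (∑ℚ-zero a))
  comb≡0′ (suc t) = rest≡0 (suc t) (comb≡0 t)

-- Gaussian elimination of the first column against the pivot row i₀.
LinIndep-eliminate : ∀ {a k} (v : Fin (suc a) → Fin (suc k) → ℚ) (i₀ : Fin (suc a))
                     (pivot≢0 : ¬ v i₀ zero ≡ 0ℚ) → LinIndep v →
                     let instance _ = ℚ.≢-nonZero pivot≢0 in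
                     LinIndep (λ i t → v (punchIn i₀ i) (suc t)
                                       - v (punchIn i₀ i) zero * ℚ.1/ (v i₀ zero) * v i₀ (suc t))
LinIndep-eliminate {a} v i₀ pivot≢0 indep μ′ comb≡0 i =
  trans (sym (VecFP.insertAt-punchIn μ′ i₀ κ i)) (indep μ comb≡0′ (punchIn i₀ i))
  where
  instance _ = ℚ.≢-nonZero pivot≢0
  p = v i₀ zero
  r : Fin a → ℚ
  r i = v (punchIn i₀ i) zero * ℚ.1/ p
  s = ∑ℚ (λ i → μ′ i * r i)
  κ = - s
  μ = insertAt μ′ i₀ κ
  expand : ∀ t → ∑ℚ (λ x → μ x * v x t) ≡ κ * v i₀ t + ∑ℚ (λ i → μ′ i * v (punchIn i₀ i) t)
  expand t = trans (∑ℚ-punchIn i₀ (λ x → μ x * v x t))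
    (cong₂ _+_ (cong (_* v i₀ t) (VecFP.insertAt-lookup μ′ i₀ κ))
               (∑ℚ-cong (λ i → cong (_* v (punchIn i₀ i) t) (VecFP.insertAt-punchIn μ′ i₀ κ i))))
  r*p : ∀ i → r i * p ≡ v (punchIn i₀ i) zero
  r*p i = trans (ℚP.*-assoc (v (punchIn i₀ i) zero) (ℚ.1/ p) p)
            (trans (cong (v (punchIn i₀ i) zero *_) (ℚP.*-inverseˡ p)) (ℚP.*-identityʳ _))
  pull : ∀ c → ∑ℚ (λ i → μ′ i * r i * c) ≡ s * c
  pull c = ∑ℚ-*ʳ c (λ i → μ′ i * r i)
  comb≡0′ : ∀ t → ∑ℚ (λ x → μ x * v x t) ≡ 0ℚ
  comb≡0′ zero = trans (expand zero) (begin
    κ * p + ∑ℚ (λ i → μ′ i * v (punchIn i₀ i) zero)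
      ≡⟨ cong (κ * p +_) (∑ℚ-cong (λ i → trans (cong (μ′ i *_) (sym (r*p i)))
                                              (sym (ℚP.*-assoc (μ′ i) (r i) p)))) ⟩
    κ * p + ∑ℚ (λ i → μ′ i * r i * p) ≡⟨ cong (κ * p +_) (pull p) ⟩
    - s * p + s * p                    ≡⟨ cancel s p ⟩
    0ℚ                                 ∎)
    where
    cancel : ∀ s p → - s * p + s * p ≡ 0ℚ
    cancel = solve ringℚ
  comb≡0′ (suc t) = trans (expand (suc t)) (begin
    - s * b + ∑ℚ (λ i → μ′ i * v (punchIn i₀ i) (suc t))
      ≡⟨ cong (- s * b +_) (∑ℚ-cong (λ i → reduce (μ′ i) (v (punchIn i₀ i) (suc t)) (r i) b)) ⟩
    - s * b + ∑ℚ (λ i → μ′ i * (v (punchIn i₀ i) (suc t) - r i * b) + μ′ i * r i * b)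
      ≡⟨ cong (- s * b +_) (trans (∑ℚ-distrib-+ (λ i → μ′ i * (v (punchIn i₀ i) (suc t) - r i * b))
                                                 (λ i → μ′ i * r i * b))
                                  (cong₂ _+_ (comb≡0 t) (pull b))) ⟩
    - s * b + (0ℚ + s * b) ≡⟨ cancel s b ⟩
    0ℚ                     ∎)
    where
    b = v i₀ (suc t)
    reduce : ∀ m x r b → m * x ≡ m * (x - r * b) + m * r * b
    reduce = solve ringℚ
    cancel : ∀ s b → - s * b + (0ℚ + s * b) ≡ 0ℚ
    cancel = solve ringℚ

¬LinIndep-suc : ∀ k (v : Fin (suc k) → Fin k → ℚ) → ¬ LinIndep v
¬LinIndep-suc zero    v indep = ℚP.1≢0 (indep (λ _ → 1ℚ) (λ ()) zero)
¬LinIndep-suc (suc k) v indep with FinP.any? (λ i → ¬? (v i zero ℚP.≟ 0ℚ))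
... | yes (i₀ , pivot≢0) = ¬LinIndep-suc k eliminated (LinIndep-eliminate v i₀ pivot≢0 indep)
  where
  instance _ = ℚ.≢-nonZero pivot≢0
  eliminated : Fin (suc k) → Fin k → ℚ
  eliminated i t = v (punchIn i₀ i) (suc t) - v (punchIn i₀ i) zero * ℚ.1/ (v i₀ zero) * v i₀ (suc t)
... | no  noPivot        = ¬LinIndep-suc k (λ i t → v (suc i) (suc t))
                                          (LinIndep-dropZeroColumn v column≡0 indep)
  where
  column≡0 : ∀ i → v i zero ≡ 0ℚ
  column≡0 i with v i zero ℚP.≟ 0ℚ
  ... | yes v≡0 = v≡0
  ... | no  v≢0 = ⊥-elim (noPivot (i , v≢0))

AffIndep-tail : ∀ {m N a} (F : Fin m → Vec ℤ N) (ι : Fin (suc a) → Fin m) →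
                AffIndep F ι → AffIndep F (ι ∘ suc)
AffIndep-tail F ι indep μ′ ∑≡0 comb≡0 i = indep (0ℚ VecF.∷ μ′) (trans (ℚP.+-identityˡ _) ∑≡0) comb≡0′ (suc i)
  where
  comb≡0′ : ∀ j → 0ℚ * pt (F (ι zero)) j + ∑ℚ (λ i → μ′ i * pt (F (ι (suc i))) j) ≡ 0ℚ
  comb≡0′ j = trans (cong (_+ ∑ℚ (λ i → μ′ i * pt (F (ι (suc i))) j)) (ℚP.*-zeroˡ (pt (F (ι zero)) j)))
                    (trans (ℚP.+-identityˡ _) (comb≡0 j))

AffIndep-shrink : ∀ {m N} (F : Fin m → Vec ℤ N) a b → b ℕ.≤ a → (ι : Fin a → Fin m) →
                  AffIndep F ι → Σ (Fin b → Fin m) (AffIndep F)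
AffIndep-shrink F zero    zero b≤a ι indep = ι , indep
AffIndep-shrink F (suc a) b   b≤a ι indep with b ℕ.≟ suc a
... | yes refl = ι , indep
... | no  b≢a  = AffIndep-shrink F a b (ℕP.≤-pred (ℕP.≤∧≢⇒< b≤a b≢a)) (ι ∘ suc) (AffIndep-tail F ι indep)

AffIndep-size< : ∀ {m N a b} (F : Fin m → Vec ℤ N) →
                 Σ (Fin a → Fin m) (AffIndep F) → (∀ (ι : Fin b → Fin m) → ¬ AffIndep F ι) → a ℕ.< b
AffIndep-size< {a = a} {b} F (ι , indep) none with b ℕ.≤? a
... | yes b≤a = ⊥-elim (none _ (proj₂ (AffIndep-shrink F a b b≤a ι indep)))
... | no  b≰a = ℕP.≰⇒> b≰a

AffComb : ∀ {b N} → (Fin b → Fin N → ℚ) → (Fin N → ℚ) → Set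
AffComb {b} {N} P x = Σ[ cf ∈ (Fin b → ℚ) ] ∑ℚ cf ≡ 1ℚ × (∀ j → ∑ℚ (λ t → cf t * P t j) ≡ x j)

¬AffComb⇒AffIndep-∷ : ∀ {m N e} (F : Fin m → Vec ℤ N) (ι : Fin e → Fin m) (g : Fin m) →
                      AffIndep F ι → ¬ AffComb (λ t → pt (F (ι t))) (pt (F g)) →
                      AffIndep F (g VecF.∷ ι)
¬AffComb⇒AffIndep-∷ {e = e} F ι g indep notComb μ ∑≡0 comb≡0 with μ zero ℚP.≟ 0ℚ
... | yes μ₀≡0 = λ { zero → μ₀≡0 ; (suc i) → indep (μ ∘ suc) ∑′≡0 comb′≡0 i }
  where
  drop₀ : ∀ {x} y → μ zero * x + y ≡ 0ℚ → y ≡ 0ℚ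
  drop₀ {x} y eq = trans (sym (trans (cong (_+ y) (trans (cong (_* x) μ₀≡0) (ℚP.*-zeroˡ x)))
                                      (ℚP.+-identityˡ y))) eq
  ∑′≡0 : ∑ℚ (μ ∘ suc) ≡ 0ℚ
  ∑′≡0 = drop₀ {1ℚ} (∑ℚ (μ ∘ suc)) (trans (cong (_+ ∑ℚ (μ ∘ suc)) (ℚP.*-identityʳ (μ zero))) ∑≡0)
  comb′≡0 : ∀ j → ∑ℚ (λ i → μ (suc i) * pt (F (ι i)) j) ≡ 0ℚ
  comb′≡0 j = drop₀ (∑ℚ (λ i → μ (suc i) * pt (F (ι i)) j)) (comb≡0 j)
... | no μ₀≢0 = ⊥-elim (notComb (cf , ∑cf≡1 , comb-cf))
  where
  instance _ = ℚ.≢-nonZero μ₀≢0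
  m₀ = μ zero
  w = ℚ.1/ m₀
  m₀*w≡1 : m₀ * w ≡ 1ℚ
  m₀*w≡1 = ℚP.*-inverseʳ m₀
  cf : Fin e → ℚ
  cf t = - (μ (suc t) * w)
  ∑cf≡1 : ∑ℚ cf ≡ 1ℚ
  ∑cf≡1 = begin
    ∑ℚ (λ t → - (μ (suc t) * w))      ≡⟨ trans (∑ℚ-neg (λ t → μ (suc t) * w)) (cong -_ (∑ℚ-*ʳ w (μ ∘ suc))) ⟩
    - (∑ℚ (μ ∘ suc) * w)              ≡⟨ regroup m₀ (∑ℚ (μ ∘ suc)) w ⟩
    m₀ * w - (m₀ + ∑ℚ (μ ∘ suc)) * w  ≡⟨ cong₂ (λ a b → a - b * w) m₀*w≡1 ∑≡0 ⟩
    1ℚ - 0ℚ * w                       ≡⟨ cong (λ z → 1ℚ - z) (ℚP.*-zeroˡ w) ⟩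
    1ℚ                                ∎
    where
    regroup : ∀ m s w → - (s * w) ≡ m * w - (m + s) * w
    regroup = solve ringℚ
  comb-cf : ∀ j → ∑ℚ (λ t → cf t * pt (F (ι t)) j) ≡ pt (F g) j
  comb-cf j = begin
    ∑ℚ (λ t → - (μ (suc t) * w) * P t) ≡⟨ ∑ℚ-cong (λ t → regroup₁ (μ (suc t)) w (P t)) ⟩
    ∑ℚ (λ t → - w * (μ (suc t) * P t)) ≡⟨ ∑ℚ-*ˡ (- w) (λ t → μ (suc t) * P t) ⟩
    - w * ∑ℚ (λ t → μ (suc t) * P t)   ≡⟨ regroup₂ w m₀ x (∑ℚ (λ t → μ (suc t) * P t)) ⟩
    (m₀ * w) * x - w * (m₀ * x + ∑ℚ (λ t → μ (suc t) * P t))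
                                       ≡⟨ cong₂ (λ a b → a * x - w * b) m₀*w≡1 (comb≡0 j) ⟩
    1ℚ * x - w * 0ℚ                    ≡⟨ regroup₃ w x ⟩
    x                                  ∎
    where
    x = pt (F g) j
    P : Fin e → ℚ
    P t = pt (F (ι t)) j
    regroup₁ : ∀ m w p → - (m * w) * p ≡ - w * (m * p)
    regroup₁ = solve ringℚ
    regroup₂ : ∀ w m x s → - w * s ≡ (m * w) * x - w * (m * x + s)
    regroup₂ = solve ringℚ
    regroup₃ : ∀ w x → 1ℚ * x - w * 0ℚ ≡ x
    regroup₃ = solve ringℚ

-- The coefficient rows are k + 2 vectors in ℚ^(k+1).
AffComb⇒¬AffIndep : ∀ {m N k} (F : Fin m → Vec ℤ N) (P : Fin (suc k) → Fin N → ℚ)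
                    (ι : Fin (suc (suc k)) → Fin m) →
                    (∀ i → AffComb P (pt (F (ι i)))) → ¬ AffIndep F ι
AffComb⇒¬AffIndep {k = k} F P ι combs indep = ¬LinIndep-suc (suc k) rows rows-indep
  where
  rows : Fin (suc (suc k)) → Fin (suc k) → ℚ
  rows i = proj₁ (combs i)
  collapse : ∀ (μ : Fin (suc (suc k)) → ℚ) (X : Fin (suc k) → ℚ) →
             (∀ t → ∑ℚ (λ i → μ i * rows i t) ≡ 0ℚ) →
             ∑ℚ (λ i → μ i * ∑ℚ (λ t → rows i t * X t)) ≡ 0ℚ
  collapse μ X μrows≡0 =
    trans (∑ℚ-*-∑ℚ μ rows X)
          (trans (∑ℚ-cong (λ t → trans (cong (_* X t) (μrows≡0 t)) (ℚP.*-zeroˡ (X t)))) (∑ℚ-zero (suc k)))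
  rows-indep : LinIndep rows
  rows-indep μ μrows≡0 = indep μ ∑μ≡0 comb≡0
    where
    ∑μ≡0 : ∑ℚ μ ≡ 0ℚ
    ∑μ≡0 = trans (∑ℚ-cong (λ i → sym (trans (cong (μ i *_) (trans (∑ℚ-cong (λ t → ℚP.*-identityʳ (rows i t)))
                                                                   (proj₁ (proj₂ (combs i)))))
                                            (ℚP.*-identityʳ (μ i)))))
                 (collapse μ (λ _ → 1ℚ) μrows≡0)
    comb≡0 : ∀ j → ∑ℚ (λ i → μ i * pt (F (ι i)) j) ≡ 0ℚ
    comb≡0 j = trans (∑ℚ-cong (λ i → cong (μ i *_) (sym (proj₂ (proj₂ (combs i)) j))))
                     (collapse μ (λ t → P t j) μrows≡0)

¬¬-∀-Fin : ∀ m {P : Fin m → Set} → (∀ i → ¬ ¬ P i) → ¬ ¬ (∀ i → P i)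
¬¬-∀-Fin zero    ¬¬P k = k (λ ())
¬¬-∀-Fin (suc m) ¬¬P k =
  ¬¬P zero (λ p₀ → ¬¬-∀-Fin m (¬¬P ∘ suc) (λ ps → k (λ { zero → p₀ ; (suc i) → ps i })))

unique∧set⇒length≡ : ∀ {A : Set} {xs ys : List A} → Unique xs → Unique ys →
                     (∀ x → (x ∈ xs → x ∈ ys) × (x ∈ ys → x ∈ xs)) → length xs ≡ length ys
unique∧set⇒length≡ xs! ys! same =
  ↭-length (∼bag⇒↭ (unique∧set⇒bag xs! ys! (λ {x} → mk⇔ (proj₁ (same x)) (proj₂ (same x)))))

data SplitView (m k : ℕ) : Fin (m ℕ.+ k) → Set where
  left  : ∀ a → SplitView m k (a ↑ˡ k)
  right : ∀ b → SplitView m k (m ↑ʳ b)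

splitView : ∀ m k (i : Fin (m ℕ.+ k)) → SplitView m k i
splitView m k i with splitAt m i in eq
... | inj₁ a = subst (SplitView m k) (FinP.splitAt⁻¹-↑ˡ eq) (left a)
... | inj₂ b = subst (SplitView m k) (FinP.splitAt⁻¹-↑ʳ eq) (right b)

cayleyNeg-↑ˡ : ∀ {m N} (S : Fin m → Vec ℤ N) a → cayleyNeg S (a ↑ˡ m) ≡ ℤ.+ 1 ∷ S a
cayleyNeg-↑ˡ {m} S a rewrite FinP.splitAt-↑ˡ m a m = refl

cayleyNeg-↑ʳ : ∀ {m N} (S : Fin m → Vec ℤ N) b → cayleyNeg S (m ↑ʳ b) ≡ ℤ.+ 0 ∷ vmap ℤ.-_ (S b)
cayleyNeg-↑ʳ {m} S b rewrite FinP.splitAt-↑ʳ m m b = refl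

pt-neg : ∀ {N} (x : Vec ℤ N) j → pt (vmap ℤ.-_ x) j ≡ - pt x j
pt-neg x j = trans (cong toℚ (VecP.lookup-map j ℤ.-_ x)) (toℚ-homo‿- (lookup x j))

pt-0 : ∀ {N} (j : Fin N) → pt (tabulate (λ _ → ℤ.+ 0)) j ≡ 0ℚ
pt-0 j = cong toℚ (VecP.lookup∘tabulate (λ _ → ℤ.+ 0) j)

-- Points are referred to by their indices: u and v index (1, 0) and (0, 0) in G₀, p and q index
-- (1, a₁) and (0, -a₁) in G, and emb maps the indices of G to those of the same points in G₀.
module Generators {d n′ : ℕ} (A : Fin d → Fin (suc n′) → ℤ) where

  n : ℕ
  n = suc n′

  G : Fin (n ℕ.+ n) → Vec ℤ (suc d)
  G = cayleyNeg (col A)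

  G₀ : Fin (suc n ℕ.+ suc n) → Vec ℤ (suc d)
  G₀ = cayleyNeg (col₀ A)

  emb : Fin (n ℕ.+ n) → Fin (suc n ℕ.+ suc n)
  emb i with splitAt n i
  ... | inj₁ a = suc a ↑ˡ suc n
  ... | inj₂ b = suc n ↑ʳ suc b

  emb-↑ˡ : ∀ a → emb (a ↑ˡ n) ≡ suc a ↑ˡ suc n
  emb-↑ˡ a rewrite FinP.splitAt-↑ˡ n a n = refl

  emb-↑ʳ : ∀ b → emb (n ↑ʳ b) ≡ suc n ↑ʳ suc b
  emb-↑ʳ b rewrite FinP.splitAt-↑ʳ n n b = refl

  u v : Fin (suc n ℕ.+ suc n)
  u = zero
  v = suc n ↑ʳ zero

  p q : Fin (n ℕ.+ n)
  p = zero ↑ˡ n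
  q = n ↑ʳ zero

  ∑ℚ-G₀ : (f : Fin (suc n ℕ.+ suc n) → ℚ) → ∑ℚ f ≡ (f u + f v) + ∑ℚ (f ∘ emb)
  ∑ℚ-G₀ f = begin
    ∑ℚ f ≡⟨ ∑ℚ-splitAt {suc n} {suc n} f ⟩
    (f u + ∑ℚ (λ (a : Fin n) → f (suc a ↑ˡ suc n))) + (f v + ∑ℚ (λ (b : Fin n) → f (suc n ↑ʳ suc b)))
      ≡⟨ ℚ+.interchange (f u) _ (f v) _ ⟩
    (f u + f v) + (∑ℚ (λ (a : Fin n) → f (suc a ↑ˡ suc n)) + ∑ℚ (λ (b : Fin n) → f (suc n ↑ʳ suc b)))
      ≡⟨ cong ((f u + f v) +_) (sym (trans (∑ℚ-splitAt {n} {n} (f ∘ emb))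
           (cong₂ _+_ (∑ℚ-cong (λ a → cong f (emb-↑ˡ a))) (∑ℚ-cong (λ b → cong f (emb-↑ʳ b)))))) ⟩
    (f u + f v) + ∑ℚ (f ∘ emb) ∎

  G₀-emb : ∀ i → G₀ (emb i) ≡ G i
  G₀-emb i with splitView n n i
  ... | left a  = trans (cong G₀ (emb-↑ˡ a)) (trans (cayleyNeg-↑ˡ (col₀ A) (suc a))
                                                    (sym (cayleyNeg-↑ˡ (col A) a)))
  ... | right b = trans (cong G₀ (emb-↑ʳ b)) (trans (cayleyNeg-↑ʳ (col₀ A) (suc b))
                                                    (sym (cayleyNeg-↑ʳ (col A) b)))

  ê₀ : Fin (suc d) → ℚ
  ê₀ zero    = 1ℚ
  ê₀ (suc j) = 0ℚ

  pt-u : ∀ j → pt (G₀ u) j ≡ ê₀ j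
  pt-u zero    = refl
  pt-u (suc j) = pt-0 j

  pt-v : ∀ j → pt (G₀ v) j ≡ 0ℚ
  pt-v j = trans (cong (λ x → pt x j) (cayleyNeg-↑ʳ (col₀ A) zero)) (coords j)
    where
    coords : ∀ j → pt (ℤ.+ 0 ∷ vmap ℤ.-_ (col₀ A zero)) j ≡ 0ℚ
    coords zero    = refl
    coords (suc j) = trans (pt-neg (col₀ A zero) j) (cong -_ (pt-0 j))

  pt-p+q : ∀ j → pt (G p) j + pt (G q) j ≡ ê₀ j
  pt-p+q j = trans (cong₂ (λ x y → pt x j + pt y j) (cayleyNeg-↑ˡ (col A) zero) (cayleyNeg-↑ʳ (col A) zero))
                   (coords j)
    where
    coords : ∀ j → pt (ℤ.+ 1 ∷ col A zero) j + pt (ℤ.+ 0 ∷ vmap ℤ.-_ (col A zero)) j ≡ ê₀ j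
    coords zero    = refl
    coords (suc j) = trans (cong (pt (col A zero) j +_) (pt-neg (col A zero) j))
                           (ℚP.+-inverseʳ (pt (col A zero) j))

  coeffs₀ : ℚ → ℚ → (Fin (n ℕ.+ n) → ℚ) → Fin (suc n ℕ.+ suc n) → ℚ
  coeffs₀ α β l zero    = α
  coeffs₀ α β l (suc i) with splitAt n i
  ... | inj₁ a       = l (a ↑ˡ n)
  ... | inj₂ zero    = β
  ... | inj₂ (suc b) = l (n ↑ʳ b)

  coeffs₀-v : ∀ α β l → coeffs₀ α β l v ≡ β
  coeffs₀-v α β l rewrite FinP.splitAt-↑ʳ n (suc n) zero = refl

  coeffs₀-emb : ∀ α β l i → coeffs₀ α β l (emb i) ≡ l i
  coeffs₀-emb α β l i with splitView n n i
  ... | left a  rewrite emb-↑ˡ a | FinP.splitAt-↑ˡ n a (suc n)       = refl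
  ... | right b rewrite emb-↑ʳ b | FinP.splitAt-↑ʳ n (suc n) (suc b) = refl

  coeffs₀-nonNeg : ∀ {α β l} → 0ℚ ℚ.≤ α → 0ℚ ℚ.≤ β → (∀ i → 0ℚ ℚ.≤ l i) →
                   ∀ i → 0ℚ ℚ.≤ coeffs₀ α β l i
  coeffs₀-nonNeg α≥0 β≥0 l≥0 zero = α≥0
  coeffs₀-nonNeg {α} {β} {l} α≥0 β≥0 l≥0 (suc i) with splitAt n i
  ... | inj₁ a       = l≥0 (a ↑ˡ n)
  ... | inj₂ zero    = β≥0
  ... | inj₂ (suc b) = l≥0 (n ↑ʳ b)

  ∑ℚ-coeffs₀ : ∀ α β l → ∑ℚ (coeffs₀ α β l) ≡ (α + β) + ∑ℚ l
  ∑ℚ-coeffs₀ α β l = trans (∑ℚ-G₀ (coeffs₀ α β l))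
    (cong₂ (λ x y → (α + x) + y) (coeffs₀-v α β l) (∑ℚ-cong (coeffs₀-emb α β l)))

  ∑ℚ-coeffs₀-G₀ : ∀ α β l j → ∑ℚ (λ i → coeffs₀ α β l i * pt (G₀ i) j)
                              ≡ α * ê₀ j + ∑ℚ (λ i → l i * pt (G i) j)
  ∑ℚ-coeffs₀-G₀ α β l j = begin
    ∑ℚ (λ i → coeffs₀ α β l i * pt (G₀ i) j)     ≡⟨ ∑ℚ-G₀ (λ i → coeffs₀ α β l i * pt (G₀ i) j) ⟩
    (α * pt (G₀ u) j + coeffs₀ α β l v * pt (G₀ v) j) + ∑ℚ (λ i → coeffs₀ α β l (emb i) * pt (G₀ (emb i)) j)
      ≡⟨ cong₂ _+_ (cong₂ _+_ (cong (α *_) (pt-u j)) (trans (cong (coeffs₀ α β l v *_) (pt-v j))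
                                                              (ℚP.*-zeroʳ (coeffs₀ α β l v))))
                   (∑ℚ-cong (λ i → cong₂ (λ x y → x * pt y j) (coeffs₀-emb α β l i) (G₀-emb i))) ⟩
    (α * ê₀ j + 0ℚ) + ∑ℚ (λ i → l i * pt (G i) j)
      ≡⟨ cong (_+ ∑ℚ (λ i → l i * pt (G i) j)) (ℚP.+-identityʳ (α * ê₀ j)) ⟩
    α * ê₀ j + ∑ℚ (λ i → l i * pt (G i) j)        ∎

  shift : ℕ → Vec ℤ (suc d) → Vec ℤ (suc d)
  shift m (x₀ ∷ x) = (x₀ ℤ.+ ℤ.+ m) ∷ x

  pt-shift : ∀ m x j → pt (shift m x) j ≡ pt x j + ℕtoℚ m * ê₀ j
  pt-shift m (x₀ ∷ x) zero    = trans (toℚ-homo-+ x₀ (ℤ.+ m)) (cong (toℚ x₀ +_) (sym (ℚP.*-identityʳ (ℕtoℚ m))))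
  pt-shift m (x₀ ∷ x) (suc j) = sym (trans (cong (pt x j +_) (ℚP.*-zeroʳ (ℕtoℚ m))) (ℚP.+-identityʳ (pt x j)))

  shift-injective : ∀ {m} {x y : Vec ℤ (suc d)} → shift m x ≡ shift m y → x ≡ y
  shift-injective {m} {x₀ ∷ x} {y₀ ∷ y} eq with VecP.∷-injective eq
  ... | x₀+m≡y₀+m , refl = cong (_∷ x) (begin
    x₀                   ≡⟨ cancel x₀ (ℤ.+ m) ⟩
    x₀ ℤ.+ ℤ.+ m ℤ.- ℤ.+ m ≡⟨ cong (λ z → z ℤ.- ℤ.+ m) x₀+m≡y₀+m ⟩
    y₀ ℤ.+ ℤ.+ m ℤ.- ℤ.+ m ≡⟨ sym (cancel y₀ (ℤ.+ m)) ⟩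
    y₀                   ∎)
    where
    cancel : ∀ a b → a ≡ a ℤ.+ b ℤ.- b
    cancel = solveℤ

  -- j·conv G sits in k·conv G₀ in two ways: topped up by (k - j)·v, or by (k - j)·u.
  InDil-G⇒InDil-G₀ : ∀ {k j y} → j ℕ.≤ k → InDil j G y → InDil k G₀ y
  InDil-G⇒InDil-G₀ {k} {j} {y} j≤k (l , l≥0 , ∑l≡j , comb) =
    coeffs₀ 0ℚ β l ,
    coeffs₀-nonNeg ℚP.≤-refl (ℕtoℚ-nonNeg (k ℕ.∸ j)) l≥0 ,
    trans (∑ℚ-coeffs₀ 0ℚ β l) (trans (cong₂ _+_ (ℚP.+-identityˡ β) ∑l≡j) (ℕtoℚ-m∸n+n j≤k)) ,
    λ t → trans (∑ℚ-coeffs₀-G₀ 0ℚ β l t)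
                (trans (cong (_+ ∑ℚ (λ i → l i * pt (G i) t)) (ℚP.*-zeroˡ (ê₀ t)))
                       (trans (ℚP.+-identityˡ _) (comb t)))
    where
    β = ℕtoℚ (k ℕ.∸ j)

  InDil-G⇒InDil-G₀-shift : ∀ {k j x} → j ℕ.≤ k → InDil j G x → InDil k G₀ (shift (k ℕ.∸ j) x)
  InDil-G⇒InDil-G₀-shift {k} {j} {x} j≤k (l , l≥0 , ∑l≡j , comb) =
    coeffs₀ α 0ℚ l ,
    coeffs₀-nonNeg (ℕtoℚ-nonNeg (k ℕ.∸ j)) ℚP.≤-refl l≥0 ,
    trans (∑ℚ-coeffs₀ α 0ℚ l) (trans (cong₂ _+_ (ℚP.+-identityʳ α) ∑l≡j) (ℕtoℚ-m∸n+n j≤k)) ,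
    λ t → trans (∑ℚ-coeffs₀-G₀ α 0ℚ l t)
                (trans (ℚP.+-comm (α * ê₀ t) _)
                       (trans (cong (_+ α * ê₀ t) (comb t)) (sym (pt-shift (k ℕ.∸ j) x t))))
    where
    α = ℕtoℚ (k ℕ.∸ j)

module Levels {d n′ : ℕ} (A : Fin d → Fin (suc n′) → ℤ) (w : Fin d → ℚ) (c : ℚ)
              (onHyperplane : ∀ i → ∑ℚ (λ j → w j * toℚ (A j i)) ≡ c) (c≢0 : ¬ c ≡ 0ℚ) where

  open Generators A public

  w· : (Fin d → ℚ) → ℚ
  w· x = ∑ℚ (λ j → w j * x j)

  Ψ : (Fin (suc d) → ℚ) → ℚ
  Ψ x = w· (x ∘ suc) - (c + c) * x zero

  Ψ-cong : ∀ {x y} → (∀ j → x j ≡ y j) → Ψ x ≡ Ψ y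
  Ψ-cong x≗y = cong₂ _-_ (∑ℚ-cong (λ j → cong (w j *_) (x≗y (suc j)))) (cong ((c + c) *_) (x≗y zero))

  Ψ-linear : ∀ {m} (λs : Fin m → ℚ) (F : Fin m → Fin (suc d) → ℚ) →
             Ψ (λ t → ∑ℚ (λ i → λs i * F i t)) ≡ ∑ℚ (λ i → λs i * Ψ (F i))
  Ψ-linear λs F = begin
    w· (λ j → ∑ℚ (λ i → λs i * F i (suc j))) - (c + c) * ∑ℚ (λ i → λs i * F i zero)
      ≡⟨ cong₂ _-_ (∑ℚ-linear w λs (λ i → F i ∘ suc)) (sym (∑ℚ-*ˡ (c + c) (λ i → λs i * F i zero))) ⟩
    ∑ℚ (λ i → λs i * w· (F i ∘ suc)) - ∑ℚ (λ i → (c + c) * (λs i * F i zero))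
      ≡⟨ sym (∑ℚ-distrib-- (λ i → λs i * w· (F i ∘ suc)) (λ i → (c + c) * (λs i * F i zero))) ⟩
    ∑ℚ (λ i → λs i * w· (F i ∘ suc) - (c + c) * (λs i * F i zero))
      ≡⟨ ∑ℚ-cong (λ i → factor (λs i) (w· (F i ∘ suc)) (c + c) (F i zero)) ⟩
    ∑ℚ (λ i → λs i * Ψ (F i)) ∎
    where
    factor : ∀ l p k f → l * p - k * (l * f) ≡ l * (p - k * f)
    factor = solve ringℚ

  w·-col : ∀ a → w· (pt (col A a)) ≡ c
  w·-col a = trans (∑ℚ-cong (λ j → cong (λ z → w j * toℚ z) (VecP.lookup∘tabulate (λ j → A j a) j)))
                   (onHyperplane a)

  w·-0 : w· (pt (col₀ A zero)) ≡ 0ℚ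
  w·-0 = trans (∑ℚ-cong (λ j → trans (cong (w j *_) (pt-0 j)) (ℚP.*-zeroʳ (w j)))) (∑ℚ-zero d)

  Ψ-G : ∀ i → Ψ (pt (G i)) ≡ - c
  Ψ-G i with splitView n n i
  ... | left a  = trans (cong (λ x → Ψ (pt x)) (cayleyNeg-↑ˡ (col A) a))
                        (trans (cong (_- (c + c) * 1ℚ) (w·-col a)) (level c))
    where
    level : ∀ c → c - (c + c) * 1ℚ ≡ - c
    level = solve ringℚ
  ... | right b = trans (cong (λ x → Ψ (pt x)) (cayleyNeg-↑ʳ (col A) b))
                        (trans (cong (_- (c + c) * 0ℚ) w·-neg) (level c))
    where
    w·-neg : w· (pt (vmap ℤ.-_ (col A b))) ≡ - c
    w·-neg = begin
      ∑ℚ (λ j → w j * pt (vmap ℤ.-_ (col A b)) j) ≡⟨ ∑ℚ-cong (λ j → trans (cong (w j *_) (pt-neg (col A b) j))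
                                                                      (sym (ℚP.neg-distribʳ-* (w j) _))) ⟩
      ∑ℚ (λ j → - (w j * pt (col A b) j))
        ≡⟨ trans (∑ℚ-neg (λ j → w j * pt (col A b) j)) (cong -_ (w·-col b)) ⟩
      - c                                          ∎
    level : ∀ c → - c - (c + c) * 0ℚ ≡ - c
    level = solve ringℚ

  Ψ-u : Ψ (pt (G₀ u)) ≡ - (c + c)
  Ψ-u = trans (cong (_- (c + c) * 1ℚ) w·-0) (level c)
    where
    level : ∀ c → 0ℚ - (c + c) * 1ℚ ≡ - (c + c)
    level = solve ringℚ

  Ψ-v : Ψ (pt (G₀ v)) ≡ 0ℚ
  Ψ-v = trans (Ψ-cong pt-v) (trans (cong (_- (c + c) * 0ℚ) (trans (∑ℚ-cong (λ j → ℚP.*-zeroʳ (w j))) (∑ℚ-zero d)))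
                                   (level c))
    where
    level : ∀ c → 0ℚ - (c + c) * 0ℚ ≡ 0ℚ
    level = solve ringℚ

  Ψ-InDil-G : ∀ {j x} → InDil j G x → Ψ (pt x) ≡ - c * ℕtoℚ j
  Ψ-InDil-G {j} {x} (l , _ , ∑l≡j , comb) = begin
    Ψ (pt x)                                    ≡⟨ Ψ-cong (λ t → sym (comb t)) ⟩
    Ψ (λ t → ∑ℚ (λ i → l i * pt (G i) t))       ≡⟨ Ψ-linear l (λ i → pt (G i)) ⟩
    ∑ℚ (λ i → l i * Ψ (pt (G i)))               ≡⟨ ∑ℚ-cong (λ i → cong (l i *_) (Ψ-G i)) ⟩
    ∑ℚ (λ i → l i * - c)                        ≡⟨ ∑ℚ-*ʳ (- c) l ⟩
    ∑ℚ l * - c                                  ≡⟨ cong (_* - c) ∑l≡j ⟩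
    ℕtoℚ j * - c                                ≡⟨ ℚP.*-comm (ℕtoℚ j) (- c) ⟩
    - c * ℕtoℚ j                                ∎

  shiftedLevel : ℕ → ℕ → ℕ
  shiftedLevel k j = k ℕ.+ (k ℕ.∸ j)

  Ψ-InDil-G-shift : ∀ {k j x} → j ℕ.≤ k → InDil j G x →
                    Ψ (pt (shift (k ℕ.∸ j) x)) ≡ - c * ℕtoℚ (shiftedLevel k j)
  Ψ-InDil-G-shift {k} {j} {x} j≤k x∈jG = begin
    Ψ (pt (shift (k ℕ.∸ j) x))          ≡⟨ Ψ-cong (pt-shift (k ℕ.∸ j) x) ⟩
    Ψ (λ t → pt x t + dℚ * ê₀ t)         ≡⟨ Ψ-shifted (pt x) ⟩
    Ψ (pt x) - (c + c) * dℚ              ≡⟨ cong (_- (c + c) * dℚ) (Ψ-InDil-G {j} {x} x∈jG) ⟩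
    - c * jℚ - (c + c) * dℚ               ≡⟨ regroup c jℚ dℚ ⟩
    - c * ((dℚ + jℚ) + dℚ)                 ≡⟨ cong (λ z → - c * (z + dℚ)) (ℕtoℚ-m∸n+n j≤k) ⟩
    - c * (ℕtoℚ k + dℚ)                  ≡⟨ cong (- c *_) (sym (ℕtoℚ-homo-+ k (k ℕ.∸ j))) ⟩
    - c * ℕtoℚ (shiftedLevel k j)       ∎
    where
    dℚ = ℕtoℚ (k ℕ.∸ j)
    jℚ = ℕtoℚ j
    Ψ-shifted : ∀ y → Ψ (λ t → y t + dℚ * ê₀ t) ≡ Ψ y - (c + c) * dℚ
    Ψ-shifted y = trans (cong₂ (λ a b → a - (c + c) * b)
                               (∑ℚ-cong (λ j → cong (w j *_) (trans (cong (y (suc j) +_) (ℚP.*-zeroʳ dℚ))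
                                                                    (ℚP.+-identityʳ (y (suc j))))))
                               (cong (y zero +_) (ℚP.*-identityʳ dℚ)))
                        (expand (w· (y ∘ suc)) c (y zero) dℚ)
      where
      expand : ∀ s c y dℚ → s - (c + c) * (y + dℚ) ≡ (s - (c + c) * y) - (c + c) * dℚ
      expand = solve ringℚ
    regroup : ∀ c jℚ dℚ → - c * jℚ - (c + c) * dℚ ≡ - c * ((dℚ + jℚ) + dℚ)
    regroup = solve ringℚ

  level-injective : ∀ {a b} → - c * ℕtoℚ a ≡ - c * ℕtoℚ b → a ≡ b
  level-injective eq = ℤP.+-injective (toℚ-injective (*-cancelˡ-≢0 -c≢0 eq))
    where
    -c≢0 : ¬ - c ≡ 0ℚ
    -c≢0 -c≡0 = c≢0 (ℚP.neg-injective -c≡0)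

  shiftedLevel-injective : ∀ {k j j′} → j ℕ.≤ k → j′ ℕ.≤ k → shiftedLevel k j ≡ shiftedLevel k j′ → j ≡ j′
  shiftedLevel-injective {k} {j} {j′} j≤k j′≤k eq = begin
    j               ≡⟨ sym (ℕP.m∸[m∸n]≡n j≤k) ⟩
    k ℕ.∸ (k ℕ.∸ j)  ≡⟨ cong (k ℕ.∸_) (ℕP.+-cancelˡ-≡ k _ _ eq) ⟩
    k ℕ.∸ (k ℕ.∸ j′) ≡⟨ ℕP.m∸[m∸n]≡n j′≤k ⟩
    j′              ∎

  shiftedLevel-> : ∀ {k j j′} → j ℕ.< k → j′ ℕ.≤ k → ¬ shiftedLevel k j ≡ j′
  shiftedLevel-> {k} {j} {j′} j<k j′≤k eq =
    ℕP.<-irrefl (sym eq) (ℕP.≤-<-trans j′≤k (ℕP.m<m+n k (ℕP.m<n⇒0<n∸m j<k)))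

module Decomposition {d n′ : ℕ} (A : Fin d → Fin (suc n′) → ℤ) (w : Fin d → ℚ) (c : ℚ)
         (onHyperplane : ∀ i → ∑ℚ (λ j → w j * toℚ (A j i)) ≡ c) (c≢0 : ¬ c ≡ 0ℚ)
         (latticePoints : ∀ (x : Vec ℤ d) → LatPt (col₀ A) x → Σ (Fin (suc (suc n′))) (λ i → x ≡ col₀ A i))
         (spanning : Spanning (col₀ A)) where

  open Levels A w c onHyperplane c≢0 public

  w·-LatPt : ∀ x → LatPt (col₀ A) x → Σ ℤ λ t → w· (pt x) ≡ c * toℚ t
  w·-LatPt x x∈P with latticePoints x x∈P
  ... | zero  , refl = ℤ.+ 0 , trans w·-0 (sym (ℚP.*-zeroʳ c))
  ... | suc a , refl = ℤ.+ 1 , trans (w·-col a) (sym (ℚP.*-identityʳ c))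

  w·-integerCombination :
    ∀ (cs : List (ℤ × Vec ℤ d)) → All (λ q → LatPt (col₀ A) (proj₂ q)) cs →
    Σ ℤ λ N → w· (λ j → toℚ (sumListℤ (lmap (λ q → proj₁ q ℤ.* lookup (hom (proj₂ q)) (suc j)) cs))) ≡ c * toℚ N
  w·-integerCombination []             []              =
    ℤ.+ 0 , trans (∑ℚ-cong (λ j → ℚP.*-zeroʳ (w j))) (trans (∑ℚ-zero d) (sym (ℚP.*-zeroʳ c)))
  w·-integerCombination ((z , x) ∷ cs) (x∈P ∷ cs∈P) with w·-LatPt x x∈P | w·-integerCombination cs cs∈P
  ... | t , w·x≡ct | N , w·R≡cN = z ℤ.* t ℤ.+ N , (begin
    w· (λ j → toℚ (z ℤ.* lookup x j ℤ.+ R j))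
      ≡⟨ ∑ℚ-cong (λ j → trans (cong (w j *_) (trans (toℚ-homo-+ (z ℤ.* lookup x j) (R j))
                                                    (cong (_+ toℚ (R j)) (toℚ-homo-* z (lookup x j)))))
                              (distrib (w j) (toℚ z) (pt x j) (toℚ (R j)))) ⟩
    ∑ℚ (λ j → toℚ z * (w j * pt x j) + w j * toℚ (R j))
      ≡⟨ trans (∑ℚ-distrib-+ (λ j → toℚ z * (w j * pt x j)) (λ j → w j * toℚ (R j)))
               (cong (_+ w· (toℚ ∘ R)) (∑ℚ-*ˡ (toℚ z) (λ j → w j * pt x j))) ⟩
    toℚ z * w· (pt x) + w· (toℚ ∘ R)  ≡⟨ cong₂ (λ a b → toℚ z * a + b) w·x≡ct w·R≡cN ⟩
    toℚ z * (c * toℚ t) + c * toℚ N   ≡⟨ factor (toℚ z) c (toℚ t) (toℚ N) ⟩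
    c * (toℚ z * toℚ t + toℚ N)       ≡⟨ cong (c *_) (sym (trans (toℚ-homo-+ (z ℤ.* t) N)
                                                                 (cong (_+ toℚ N) (toℚ-homo-* z t)))) ⟩
    c * toℚ (z ℤ.* t ℤ.+ N)            ∎)
    where
    R : Fin d → ℤ
    R j = sumListℤ (lmap (λ q → proj₁ q ℤ.* lookup (hom (proj₂ q)) (suc j)) cs)
    distrib : ∀ w z p r → w * (z * p + r) ≡ z * (w * p) + w * r
    distrib = solve ringℚ
    factor : ∀ z c t n → z * (c * t) + c * n ≡ c * (z * t + n)
    factor = solve ringℚ

  LatPt-col₀ : ∀ a → LatPt (col₀ A) (col₀ A a)
  LatPt-col₀ a = δ a , δ-nonNeg a , ∑ℚ-δ a , λ j → ∑ℚ-δ-* a (λ i → pt (col₀ A i) j)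

  -- (0, y) = ∑ₐ μₐ (1, aₐ) + κ (1, 0), where μₐ is the weight of (1, aₐ) minus that of (0, -aₐ).
  InDil-G₀⇒InQSpan : ∀ {k y₀ y} → InDil k G₀ (y₀ ∷ y) → InQSpan (col₀ A) (ℤ.+ 0 ∷ y)
  InDil-G₀⇒InQSpan {k} {y₀} {y} (l₀ , _ , _ , comb) = cs , cs∈P , coords
    where
    μ : Fin (suc n) → ℚ
    μ a = l₀ (a ↑ˡ suc n) - l₀ (suc n ↑ʳ a)
    κ = - ∑ℚ μ
    cs : List (ℚ × Vec ℤ d)
    cs = (κ , col₀ A zero) ∷ List.tabulate (λ a → μ a , col₀ A a)
    cs∈P : All (λ q → LatPt (col₀ A) (proj₂ q)) cs
    cs∈P = LatPt-col₀ zero ∷ AllP.tabulate⁺ {f = λ a → μ a , col₀ A a} LatPt-col₀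
    sumList-tabulate : ∀ j → sumListℚ (lmap (λ q → proj₁ q * toℚ (lookup (hom (proj₂ q)) j))
                                            (List.tabulate (λ a → μ a , col₀ A a)))
                             ≡ ∑ℚ (λ a → μ a * toℚ (lookup (hom (col₀ A a)) j))
    sumList-tabulate j = go (λ a → μ a , col₀ A a)
      where
      go : ∀ {m} (f : Fin m → ℚ × Vec ℤ d) →
           sumListℚ (lmap (λ q → proj₁ q * toℚ (lookup (hom (proj₂ q)) j)) (List.tabulate f))
             ≡ ∑ℚ (λ i → proj₁ (f i) * toℚ (lookup (hom (proj₂ (f i))) j))
      go {zero}  f = refl
      go {suc m} f = cong (proj₁ (f zero) * toℚ (lookup (hom (proj₂ (f zero))) j) +_) (go (f ∘ suc))
    comb-y : ∀ j → ∑ℚ (λ a → μ a * pt (col₀ A a) j) ≡ pt y j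
    comb-y j = begin
      ∑ℚ (λ a → μ a * pt (col₀ A a) j)
        ≡⟨ ∑ℚ-cong (λ a → split (l₀ (a ↑ˡ suc n)) (l₀ (suc n ↑ʳ a)) (pt (col₀ A a) j)) ⟩
      ∑ℚ (λ a → up a + down a)
        ≡⟨ ∑ℚ-distrib-+ up down ⟩
      ∑ℚ up + ∑ℚ down
        ≡⟨ cong₂ _+_ (∑ℚ-cong (λ a → cong (λ x → l₀ (a ↑ˡ suc n) * pt x (suc j))
                                          (sym (cayleyNeg-↑ˡ (col₀ A) a))))
                     (∑ℚ-cong (λ a → cong (l₀ (suc n ↑ʳ a) *_)
                                          (trans (sym (pt-neg (col₀ A a) j))
                                                 (cong (λ x → pt x (suc j)) (sym (cayleyNeg-↑ʳ (col₀ A) a)))))) ⟩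
      ∑ℚ (λ (a : Fin (suc n)) → l₀ (a ↑ˡ suc n) * pt (G₀ (a ↑ˡ suc n)) (suc j))
        + ∑ℚ (λ (a : Fin (suc n)) → l₀ (suc n ↑ʳ a) * pt (G₀ (suc n ↑ʳ a)) (suc j))
        ≡⟨ sym (∑ℚ-splitAt {suc n} {suc n} (λ i → l₀ i * pt (G₀ i) (suc j))) ⟩
      ∑ℚ (λ i → l₀ i * pt (G₀ i) (suc j)) ≡⟨ comb (suc j) ⟩
      pt y j ∎
      where
      up down : Fin (suc n) → ℚ
      up   a = l₀ (a ↑ˡ suc n) * pt (col₀ A a) j
      down a = l₀ (suc n ↑ʳ a) * - pt (col₀ A a) j
      split : ∀ a b x → (a - b) * x ≡ a * x + b * - x
      split = solve ringℚ
    coords : ∀ j → sumListℚ (lmap (λ q → proj₁ q * toℚ (lookup (hom (proj₂ q)) j)) cs)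
                   ≡ toℚ (lookup (ℤ.+ 0 ∷ y) j)
    coords zero    = trans (cong (κ * 1ℚ +_) (trans (sumList-tabulate zero)
                                                    (∑ℚ-cong (λ a → ℚP.*-identityʳ (μ a)))))
                           (cancel (∑ℚ μ))
      where
      cancel : ∀ s → - s * 1ℚ + s ≡ 0ℚ
      cancel = solve ringℚ
    coords (suc j) = trans (cong₂ _+_ (trans (cong (κ *_) (pt-0 j)) (ℚP.*-zeroʳ κ))
                                      (trans (sumList-tabulate (suc j)) (comb-y j)))
                           (ℚP.+-identityˡ (pt y j))

  w·-InZSpan : ∀ {z₀ y} → InZSpan (col₀ A) (z₀ ∷ y) → Σ ℤ λ N → w· (pt y) ≡ c * toℚ N
  w·-InZSpan {z₀} {y} (cs , cs∈P , coords) =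
    let N , w·≡cN = w·-integerCombination cs cs∈P
    in  N , trans (∑ℚ-cong (λ j → cong (λ z → w j * toℚ z) (sym (coords (suc j))))) w·≡cN

  w·-InDil-G₀ : ∀ {k y₀ y} → InDil k G₀ (y₀ ∷ y) → Σ ℤ λ N → w· (pt y) ≡ c * toℚ N
  w·-InDil-G₀ {k} {y₀} {y} y∈kG₀ = w·-InZSpan (spanning (ℤ.+ 0 ∷ y) (InDil-G₀⇒InQSpan {k} {y₀} y∈kG₀))

  -- Comparing Ψ(y) = c N - 2c y₀ with Ψ(y) = -2c α - c ∑l and using α + β + ∑l = k.
  coefficient-gap : ∀ {k y₀ y} (y∈kG₀ : InDil k G₀ (y₀ ∷ y)) N → w· (pt y) ≡ c * toℚ N →
                    let l₀ = proj₁ y∈kG₀ in l₀ v - l₀ u ≡ toℚ (N ℤ.- (y₀ ℤ.+ y₀) ℤ.+ ℤ.+ k)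
  coefficient-gap {k} {y₀} {y} (l₀ , _ , ∑l₀≡k , comb) N w·y≡cN = sym (trans toℚM (*-cancelˡ-≢0 c≢0 (begin
    c * (toℚ N - (Y + Y) + K)                         ≡⟨ cong (λ z → c * (toℚ N - (Y + Y) + z)) (sym ∑≡K) ⟩
    c * (toℚ N - (Y + Y) + ((α + β) + s))             ≡⟨ expand c (toℚ N) Y α β s ⟩
    (c * toℚ N - (c + c) * Y) + c * ((α + β) + s)
      ≡⟨ cong (_+ c * ((α + β) + s)) (trans (sym Ψ-via-N) Ψ-via-l₀) ⟩
    ((α * - (c + c) + β * 0ℚ) + s * - c) + c * ((α + β) + s) ≡⟨ collect c α β s ⟩
    c * (β - α)                                       ∎)))
    where
    α  = l₀ u
    β  = l₀ v
    l  = l₀ ∘ emb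
    s  = ∑ℚ l
    K  = ℕtoℚ k
    Y  = toℚ y₀
    ∑≡K : (α + β) + s ≡ K
    ∑≡K = trans (sym (∑ℚ-G₀ l₀)) ∑l₀≡k
    Ψ-via-N : Ψ (pt (y₀ ∷ y)) ≡ c * toℚ N - (c + c) * Y
    Ψ-via-N = cong (_- (c + c) * Y) w·y≡cN
    Ψ-via-l₀ : Ψ (pt (y₀ ∷ y)) ≡ (α * - (c + c) + β * 0ℚ) + s * - c
    Ψ-via-l₀ = begin
      Ψ (pt (y₀ ∷ y))                          ≡⟨ Ψ-cong (λ t → sym (comb t)) ⟩
      Ψ (λ t → ∑ℚ (λ i → l₀ i * pt (G₀ i) t))  ≡⟨ Ψ-linear l₀ (λ i → pt (G₀ i)) ⟩
      ∑ℚ (λ i → l₀ i * Ψ (pt (G₀ i)))          ≡⟨ ∑ℚ-G₀ (λ i → l₀ i * Ψ (pt (G₀ i))) ⟩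
      (α * Ψ (pt (G₀ u)) + β * Ψ (pt (G₀ v))) + ∑ℚ (λ i → l i * Ψ (pt (G₀ (emb i))))
        ≡⟨ cong₂ _+_ (cong₂ _+_ (cong (α *_) Ψ-u) (cong (β *_) Ψ-v))
                     (trans (∑ℚ-cong (λ i → cong (l i *_) (trans (cong (λ x → Ψ (pt x)) (G₀-emb i)) (Ψ-G i))))
                            (∑ℚ-*ʳ (- c) l)) ⟩
      (α * - (c + c) + β * 0ℚ) + s * - c       ∎
    toℚM : toℚ (N ℤ.- (y₀ ℤ.+ y₀) ℤ.+ ℤ.+ k) ≡ toℚ N - (Y + Y) + K
    toℚM = trans (toℚ-homo-+ (N ℤ.- (y₀ ℤ.+ y₀)) (ℤ.+ k))
             (cong (_+ K) (trans (toℚ-homo-+ N (ℤ.- (y₀ ℤ.+ y₀)))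
               (cong (toℚ N +_) (trans (toℚ-homo‿- (y₀ ℤ.+ y₀)) (cong -_ (toℚ-homo-+ y₀ y₀))))))
    expand : ∀ c N Y α β s → c * (N - (Y + Y) + ((α + β) + s)) ≡ (c * N - (c + c) * Y) + c * ((α + β) + s)
    expand = solve ringℚ
    collect : ∀ c α β s → ((α * - (c + c) + β * 0ℚ) + s * - c) + c * ((α + β) + s) ≡ c * (β - α)
    collect = solve ringℚ

  -- Since u = p + q, weight a on u can be moved onto p and q.
  topUp : ℚ → (Fin (n ℕ.+ n) → ℚ) → Fin (n ℕ.+ n) → ℚ
  topUp a l i = l i + a * (δ p i + δ q i)

  ∑ℚ-topUp-* : ∀ a l (g : Fin (n ℕ.+ n) → ℚ) →
               ∑ℚ (λ i → topUp a l i * g i) ≡ ∑ℚ (λ i → l i * g i) + a * (g p + g q)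
  ∑ℚ-topUp-* a l g = begin
    ∑ℚ (λ i → topUp a l i * g i)
      ≡⟨ ∑ℚ-cong (λ i → distrib (l i) a (δ p i) (δ q i) (g i)) ⟩
    ∑ℚ (λ i → l i * g i + a * (δ p i * g i + δ q i * g i))
      ≡⟨ ∑ℚ-distrib-+ (λ i → l i * g i) (λ i → a * (δ p i * g i + δ q i * g i)) ⟩
    ∑ℚ (λ i → l i * g i) + ∑ℚ (λ i → a * (δ p i * g i + δ q i * g i))
      ≡⟨ cong (∑ℚ (λ i → l i * g i) +_)
              (trans (∑ℚ-*ˡ a (λ i → δ p i * g i + δ q i * g i))
                     (cong (a *_) (trans (∑ℚ-distrib-+ (λ i → δ p i * g i) (λ i → δ q i * g i))
                                         (cong₂ _+_ (∑ℚ-δ-* p g) (∑ℚ-δ-* q g))))) ⟩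
    ∑ℚ (λ i → l i * g i) + a * (g p + g q) ∎
    where
    distrib : ∀ l a x y g → (l + a * (x + y)) * g ≡ l * g + a * (x * g + y * g)
    distrib = solve ringℚ

  InDil-G-topUp : ∀ {j y} a l → 0ℚ ℚ.≤ a → (∀ i → 0ℚ ℚ.≤ l i) → ∑ℚ l + (a + a) ≡ ℕtoℚ j →
                  (∀ t → a * ê₀ t + ∑ℚ (λ i → l i * pt (G i) t) ≡ pt y t) → InDil j G y
  InDil-G-topUp {j} {y} a l a≥0 l≥0 ∑≡j comb = topUp a l , nonNeg , ∑topUp≡j , combTopUp
    where
    nonNeg : ∀ i → 0ℚ ℚ.≤ topUp a l i
    nonNeg i = ℚP.+-mono-≤ (l≥0 i) (ℚP.nonNegative⁻¹ (a * (δ p i + δ q i))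
                 {{ℚP.nonNeg*nonNeg⇒nonNeg a {{ℚ.nonNegative a≥0}} _
                    {{ℚ.nonNegative (ℚP.+-mono-≤ (δ-nonNeg p i) (δ-nonNeg q i))}}}})
    ∑topUp≡j : ∑ℚ (topUp a l) ≡ ℕtoℚ j
    ∑topUp≡j = begin
      ∑ℚ (topUp a l)                       ≡⟨ ∑ℚ-cong (λ i → sym (ℚP.*-identityʳ (topUp a l i))) ⟩
      ∑ℚ (λ i → topUp a l i * 1ℚ)          ≡⟨ ∑ℚ-topUp-* a l (λ _ → 1ℚ) ⟩
      ∑ℚ (λ i → l i * 1ℚ) + a * (1ℚ + 1ℚ)  ≡⟨ cong₂ _+_ (∑ℚ-cong (λ i → ℚP.*-identityʳ (l i))) (twice a) ⟩
      ∑ℚ l + (a + a)                       ≡⟨ ∑≡j ⟩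
      ℕtoℚ j                               ∎
      where
      twice : ∀ a → a * (1ℚ + 1ℚ) ≡ a + a
      twice = solve ringℚ
    combTopUp : ∀ t → ∑ℚ (λ i → topUp a l i * pt (G i) t) ≡ pt y t
    combTopUp t = trans (∑ℚ-topUp-* a l (λ i → pt (G i) t))
                        (trans (cong (λ z → ∑ℚ (λ i → l i * pt (G i) t) + a * z) (pt-p+q t))
                               (trans (ℚP.+-comm _ (a * ê₀ t)) (comb t)))

  Below Shifted : ℕ → Vec ℤ (suc d) → Set
  Below   k y = Σ[ j ∈ ℕ ] j ℕ.≤ k × InDil j G y
  Shifted k y = Σ[ j ∈ ℕ ] j ℕ.< k × Σ[ x ∈ Vec ℤ (suc d) ] InDil j G x × y ≡ shift (k ℕ.∸ j) x

  ∑ℚ-G₀-comb : ∀ (l₀ : Fin (suc n ℕ.+ suc n) → ℚ) t →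
               ∑ℚ (λ i → l₀ i * pt (G₀ i) t) ≡ l₀ u * ê₀ t + ∑ℚ (λ i → l₀ (emb i) * pt (G i) t)
  ∑ℚ-G₀-comb l₀ t = begin
    ∑ℚ (λ i → l₀ i * pt (G₀ i) t)
      ≡⟨ ∑ℚ-G₀ (λ i → l₀ i * pt (G₀ i) t) ⟩
    (l₀ u * pt (G₀ u) t + l₀ v * pt (G₀ v) t) + ∑ℚ (λ i → l₀ (emb i) * pt (G₀ (emb i)) t)
      ≡⟨ cong₂ _+_ (cong₂ _+_ (cong (l₀ u *_) (pt-u t)) (trans (cong (l₀ v *_) (pt-v t)) (ℚP.*-zeroʳ (l₀ v))))
                   (∑ℚ-cong (λ i → cong (λ x → l₀ (emb i) * pt x t) (G₀-emb i))) ⟩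
    (l₀ u * ê₀ t + 0ℚ) + ∑ℚ (λ i → l₀ (emb i) * pt (G i) t)
      ≡⟨ cong (_+ ∑ℚ (λ i → l₀ (emb i) * pt (G i) t)) (ℚP.+-identityʳ (l₀ u * ê₀ t)) ⟩
    l₀ u * ê₀ t + ∑ℚ (λ i → l₀ (emb i) * pt (G i) t) ∎

  -- β ≥ α: move α from u onto p + q and drop what is left on v.
  Below-from-gap : ∀ {k y} (y∈kG₀ : InDil k G₀ y) r →
                   let l₀ = proj₁ y∈kG₀ in l₀ v - l₀ u ≡ ℕtoℚ r → Below k y
  Below-from-gap {k} {y} (l₀ , l₀≥0 , ∑l₀≡k , comb) r β-α≡r =
    k ℕ.∸ r , ℕP.m∸n≤m k r ,
    InDil-G-topUp {k ℕ.∸ r} {y} α (l₀ ∘ emb) (l₀≥0 u) (l₀≥0 ∘ emb) (proj₂ bound)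
                  (λ t → trans (sym (∑ℚ-G₀-comb l₀ t)) (comb t))
    where
    α = l₀ u
    s = ∑ℚ (l₀ ∘ emb)
    regroup : ∀ a b s → s + (a + a) ≡ ((a + b) + s) - (b - a)
    regroup = solve ringℚ
    bound : r ℕ.≤ k × s + (α + α) ≡ ℕtoℚ (k ℕ.∸ r)
    bound = ℕtoℚ-∸ (s + (α + α))
              (ℚP.+-mono-≤ (∑ℚ-nonNeg (l₀ ∘ emb) (l₀≥0 ∘ emb)) (ℚP.+-mono-≤ (l₀≥0 u) (l₀≥0 u)))
              (trans (regroup α (l₀ v) s) (cong₂ _-_ (trans (sym (∑ℚ-G₀ l₀)) ∑l₀≡k) β-α≡r))

  -- α > β: move β from u onto p + q; the excess (α - β)·u is the shift.
  Shifted-from-gap : ∀ {k y₀ y} (y∈kG₀ : InDil k G₀ (y₀ ∷ y)) m →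
                     let l₀ = proj₁ y∈kG₀ in l₀ v - l₀ u ≡ - ℕtoℚ (suc m) → Shifted k (y₀ ∷ y)
  Shifted-from-gap {k} {y₀} {y} (l₀ , l₀≥0 , ∑l₀≡k , comb) m β-α≡-m =
    k ℕ.∸ suc m , ℕP.∸-monoʳ-< (s≤s z≤n) (proj₁ bound) , x ,
    InDil-G-topUp {k ℕ.∸ suc m} {x} β (l₀ ∘ emb) (l₀≥0 v) (l₀≥0 ∘ emb) (proj₂ bound) comb-x ,
    y≡shift
    where
    α = l₀ u
    β = l₀ v
    s = ∑ℚ (l₀ ∘ emb)
    M = ℕtoℚ (suc m)
    x = (y₀ ℤ.- ℤ.+ suc m) ∷ y
    regroup : ∀ a b s → s + (b + b) ≡ ((a + b) + s) + (b - a)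
    regroup = solve ringℚ
    bound : suc m ℕ.≤ k × s + (β + β) ≡ ℕtoℚ (k ℕ.∸ suc m)
    bound = ℕtoℚ-∸ (s + (β + β))
              (ℚP.+-mono-≤ (∑ℚ-nonNeg (l₀ ∘ emb) (l₀≥0 ∘ emb)) (ℚP.+-mono-≤ (l₀≥0 v) (l₀≥0 v)))
              (trans (regroup α β s) (cong₂ _+_ (trans (sym (∑ℚ-G₀ l₀)) ∑l₀≡k) β-α≡-m))
    pt-x : ∀ t → pt (y₀ ∷ y) t + - M * ê₀ t ≡ pt x t
    pt-x zero    = trans (cong (toℚ y₀ +_) (ℚP.*-identityʳ (- M)))
                         (sym (trans (toℚ-homo-+ y₀ (ℤ.- ℤ.+ suc m)) (cong (toℚ y₀ +_) (toℚ-homo‿- (ℤ.+ suc m)))))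
    pt-x (suc j) = trans (cong (pt y j +_) (ℚP.*-zeroʳ (- M))) (ℚP.+-identityʳ (pt y j))
    move : ∀ a b e g → b * e + g ≡ (a * e + g) + (b - a) * e
    move = solve ringℚ
    comb-x : ∀ t → β * ê₀ t + ∑ℚ (λ i → l₀ (emb i) * pt (G i) t) ≡ pt x t
    comb-x t = begin
      β * ê₀ t + S                    ≡⟨ move α β (ê₀ t) S ⟩
      (α * ê₀ t + S) + (β - α) * ê₀ t ≡⟨ cong₂ (λ a b → a + b * ê₀ t) (trans (sym (∑ℚ-G₀-comb l₀ t)) (comb t))
                                               β-α≡-m ⟩
      pt (y₀ ∷ y) t + - M * ê₀ t      ≡⟨ pt-x t ⟩
      pt x t                          ∎
      where
      S = ∑ℚ (λ i → l₀ (emb i) * pt (G i) t)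
    cancel : ∀ a b → a ℤ.- b ℤ.+ b ≡ a
    cancel = solveℤ
    y≡shift : y₀ ∷ y ≡ shift (k ℕ.∸ (k ℕ.∸ suc m)) x
    y≡shift = sym (trans (cong (λ j → shift j x) (ℕP.m∸[m∸n]≡n (proj₁ bound)))
                         (cong (_∷ y) (cancel y₀ (ℤ.+ suc m))))

  InDil-G₀-split : ∀ {k y} → InDil k G₀ y → Below k y ⊎ Shifted k y
  InDil-G₀-split {k} {y₀ ∷ y} y∈kG₀ =
    let N , w·y≡cN = w·-InDil-G₀ {k} {y₀} y∈kG₀
    in  bySign (N ℤ.- (y₀ ℤ.+ y₀) ℤ.+ ℤ.+ k) (coefficient-gap {k} {y₀} y∈kG₀ N w·y≡cN)
    where
    bySign : ∀ M → proj₁ y∈kG₀ v - proj₁ y∈kG₀ u ≡ toℚ M → Below k (y₀ ∷ y) ⊎ Shifted k (y₀ ∷ y)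
    bySign (ℤ.+ r)      β-α≡r  = inj₁ (Below-from-gap {k} {y₀ ∷ y} y∈kG₀ r β-α≡r)
    bySign (ℤ.-[1+ m ]) β-α≡-m =
      inj₂ (Shifted-from-gap {k} {y₀} {y} y∈kG₀ m (trans β-α≡-m (toℚ-homo‿- (ℤ.+ suc m))))

module Counting {d n′ : ℕ} (A : Fin d → Fin (suc n′) → ℤ) (w : Fin d → ℚ) (c : ℚ)
         (onHyperplane : ∀ i → ∑ℚ (λ j → w j * toℚ (A j i)) ≡ c) (c≢0 : ¬ c ≡ 0ℚ)
         (latticePoints : ∀ (x : Vec ℤ d) → LatPt (col₀ A) x → Σ (Fin (suc (suc n′))) (λ i → x ≡ col₀ A i))
         (spanning : Spanning (col₀ A))
         (L : ℕ → ℕ) (ehrhart : IsEhrhartFunction (cayleyNeg (col A)) L) where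

  open Decomposition A w c onHyperplane c≢0 latticePoints spanning public

  origin : Vec ℤ (suc d)
  origin = tabulate (λ _ → ℤ.+ 0)

  InDil-0⇒origin : ∀ {x} → InDil 0 G x → x ≡ origin
  InDil-0⇒origin {x} (l , l≥0 , ∑l≡0 , comb) =
    trans (sym (VecP.tabulate∘lookup x))
          (VecP.tabulate-cong (λ j → toℚ-injective {lookup x j} {ℤ.+ 0} (trans (sym (comb j)) (vanish j))))
    where
    vanish : ∀ j → ∑ℚ (λ i → l i * pt (G i) j) ≡ 0ℚ
    vanish j = trans (∑ℚ-cong (λ i → trans (cong (_* pt (G i) j) (∑ℚ-nonNeg-≡0 l l≥0 ∑l≡0 i))
                                           (ℚP.*-zeroˡ (pt (G i) j))))
                     (∑ℚ-zero (n ℕ.+ n))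

  origin∈0G : InDil 0 G origin
  origin∈0G = (λ _ → 0ℚ) , (λ _ → ℚP.≤-refl) , ∑ℚ-zero (n ℕ.+ n) ,
              λ j → trans (trans (∑ℚ-cong (λ i → ℚP.*-zeroˡ (pt (G i) j))) (∑ℚ-zero (n ℕ.+ n)))
                          (sym (pt-0 j))

  pointsG : ℕ → List (Vec ℤ (suc d))
  pointsG zero    = origin ∷ []
  pointsG (suc j) = proj₁ (ehrhart (suc j) (s≤s z≤n))

  pointsG-sound : ∀ j {x} → x ∈ pointsG j → InDil j G x
  pointsG-sound zero    (here refl) = origin∈0G
  pointsG-sound (suc j) {x} x∈ = let _ , _ , _ , same = ehrhart (suc j) (s≤s z≤n) in proj₁ (same x) x∈

  pointsG-complete : ∀ j {x} → InDil j G x → x ∈ pointsG j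
  pointsG-complete zero    x∈0G = here (InDil-0⇒origin x∈0G)
  pointsG-complete (suc j) {x} x∈jG = let _ , _ , _ , same = ehrhart (suc j) (s≤s z≤n) in proj₂ (same x) x∈jG

  pointsG-unique : ∀ j → Unique (pointsG j)
  pointsG-unique zero    = [] ∷ []
  pointsG-unique (suc j) = let _ , unique , _ = ehrhart (suc j) (s≤s z≤n) in unique

  length-pointsG : ∀ j → length (pointsG (suc j)) ≡ L (suc j)
  length-pointsG j = let _ , _ , length≡ , _ = ehrhart (suc j) (s≤s z≤n) in length≡

  belowList : ℕ → List (Vec ℤ (suc d))
  belowList zero    = pointsG zero
  belowList (suc t) = pointsG (suc t) ++ belowList t

  shiftedList : ℕ → ℕ → List (Vec ℤ (suc d))
  shiftedList k zero    = []
  shiftedList k (suc t) = lmap (shift (k ℕ.∸ t)) (pointsG t) ++ shiftedList k t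

  length-belowList : ∀ t → length (belowList t) ≡ cumulative L t
  length-belowList zero    = refl
  length-belowList (suc t) =
    trans (ListP.length-++ (pointsG (suc t)))
          (trans (cong₂ ℕ._+_ (length-pointsG t) (length-belowList t))
                 (ℕP.+-comm (L (suc t)) (cumulative L t)))

  length-shiftedList : ∀ k t → length (shiftedList k (suc t)) ≡ cumulative L t
  length-shiftedList k zero    = refl
  length-shiftedList k (suc t) =
    trans (ListP.length-++ (lmap (shift (k ℕ.∸ suc t)) (pointsG (suc t))))
          (trans (cong₂ ℕ._+_ (trans (ListP.length-map (shift (k ℕ.∸ suc t)) (pointsG (suc t)))
                                     (length-pointsG t))
                              (length-shiftedList k t))
                 (ℕP.+-comm (L (suc t)) (cumulative L t)))

  belowList-sound : ∀ t {y} → y ∈ belowList t → Below t y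
  belowList-sound zero    y∈ = 0 , z≤n , pointsG-sound 0 y∈
  belowList-sound (suc t) y∈ with ∈-++⁻ (pointsG (suc t)) y∈
  ... | inj₁ y∈pointsG = suc t , ℕP.≤-refl , pointsG-sound (suc t) y∈pointsG
  ... | inj₂ y∈below  with belowList-sound t y∈below
  ...   | j , j≤t , y∈jG = j , ℕP.m≤n⇒m≤1+n j≤t , y∈jG

  belowList-complete : ∀ t {y j} → j ℕ.≤ t → InDil j G y → y ∈ belowList t
  belowList-complete zero    {j = zero} z≤n y∈jG = pointsG-complete 0 y∈jG
  belowList-complete (suc t) {j = j} j≤t y∈jG with j ℕ.≟ suc t
  ... | yes refl = ∈-++⁺ˡ (pointsG-complete (suc t) y∈jG)
  ... | no  j≢t  = ∈-++⁺ʳ (pointsG (suc t)) (belowList-complete t (ℕP.≤-pred (ℕP.≤∧≢⇒< j≤t j≢t)) y∈jG)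

  shiftedList-sound : ∀ k t {y} → y ∈ shiftedList k t →
                      Σ[ j ∈ ℕ ] j ℕ.< t × Σ[ x ∈ Vec ℤ (suc d) ] InDil j G x × y ≡ shift (k ℕ.∸ j) x
  shiftedList-sound k (suc t) y∈ with ∈-++⁻ (lmap (shift (k ℕ.∸ t)) (pointsG t)) y∈
  ... | inj₁ y∈map with ∈-map⁻ (shift (k ℕ.∸ t)) y∈map
  ...   | x , x∈pointsG , y≡ = t , ℕP.≤-refl , x , pointsG-sound t x∈pointsG , y≡
  shiftedList-sound k (suc t) y∈ | inj₂ y∈shifted with shiftedList-sound k t y∈shifted
  ...   | j , j<t , x , x∈jG , y≡ = j , ℕP.m≤n⇒m≤1+n j<t , x , x∈jG , y≡

  shiftedList-complete : ∀ k t {x j} → j ℕ.< t → InDil j G x → shift (k ℕ.∸ j) x ∈ shiftedList k t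
  shiftedList-complete k (suc t) {j = j} j<t x∈jG with j ℕ.≟ t
  ... | yes refl = ∈-++⁺ˡ (∈-map⁺ (shift (k ℕ.∸ t)) (pointsG-complete t x∈jG))
  ... | no  j≢t  = ∈-++⁺ʳ (lmap (shift (k ℕ.∸ t)) (pointsG t))
                          (shiftedList-complete k t (ℕP.≤∧≢⇒< (ℕP.≤-pred j<t) j≢t) x∈jG)

  -- Ψ separates all the pieces: -c·j on j·conv G and -c·(2k - j) on its shift.
  belowList-unique : ∀ t → Unique (belowList t)
  belowList-unique zero    = pointsG-unique 0
  belowList-unique (suc t) = UniqueP.++⁺ (pointsG-unique (suc t)) (belowList-unique t) disjoint
    where
    disjoint : ∀ {y} → ¬ (y ∈ pointsG (suc t) × y ∈ belowList t)
    disjoint {y} (y∈pointsG , y∈below) with belowList-sound t y∈below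
    ... | j , j≤t , y∈jG = ℕP.<-irrefl j≡1+t (s≤s j≤t)
      where
      j≡1+t : j ≡ suc t
      j≡1+t = level-injective (trans (sym (Ψ-InDil-G {j} {y} y∈jG))
                                     (Ψ-InDil-G {suc t} {y} (pointsG-sound (suc t) y∈pointsG)))

  shiftedList-unique : ∀ k t → t ℕ.≤ k → Unique (shiftedList k t)
  shiftedList-unique k zero    t≤k = []
  shiftedList-unique k (suc t) t<k =
    UniqueP.++⁺ (UniqueP.map⁺ shift-injective (pointsG-unique t)) (shiftedList-unique k t (ℕP.<⇒≤ t<k)) disjoint
    where
    disjoint : ∀ {y} → ¬ (y ∈ lmap (shift (k ℕ.∸ t)) (pointsG t) × y ∈ shiftedList k t)
    disjoint (y∈map , y∈shifted) with ∈-map⁻ (shift (k ℕ.∸ t)) y∈map | shiftedList-sound k t y∈shifted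
    ... | x , x∈pointsG , refl | j , j<t , x′ , x′∈jG , y≡ =
      ℕP.<-irrefl (sym t≡j) j<t
      where
      t≡j : t ≡ j
      t≡j = shiftedLevel-injective (ℕP.<⇒≤ t<k) (ℕP.≤-trans (ℕP.<⇒≤ j<t) (ℕP.<⇒≤ t<k))
              (level-injective {shiftedLevel k t} {shiftedLevel k j}
                 (trans (sym (Ψ-InDil-G-shift {k} {t} {x} (ℕP.<⇒≤ t<k) (pointsG-sound t x∈pointsG)))
                        (trans (cong (λ z → Ψ (pt z)) y≡)
                               (Ψ-InDil-G-shift {k} {j} {x′} (ℕP.≤-trans (ℕP.<⇒≤ j<t) (ℕP.<⇒≤ t<k)) x′∈jG))))

  pointsG₀ : ℕ → List (Vec ℤ (suc d))
  pointsG₀ k = belowList k ++ shiftedList k k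

  pointsG₀-unique : ∀ k → Unique (pointsG₀ k)
  pointsG₀-unique k = UniqueP.++⁺ (belowList-unique k) (shiftedList-unique k k ℕP.≤-refl) disjoint
    where
    disjoint : ∀ {y} → ¬ (y ∈ belowList k × y ∈ shiftedList k k)
    disjoint (y∈below , y∈shifted) with belowList-sound k y∈below | shiftedList-sound k k y∈shifted
    ... | j′ , j′≤k , y∈j′G | j , j<k , x , x∈jG , refl =
      shiftedLevel-> j<k j′≤k (level-injective {shiftedLevel k j} {j′}
                                 (trans (sym (Ψ-InDil-G-shift {k} {j} {x} (ℕP.<⇒≤ j<k) x∈jG))
                                        (Ψ-InDil-G {j′} {shift (k ℕ.∸ j) x} y∈j′G)))

  pointsG₀-complete : ∀ k {y} → InDil k G₀ y → y ∈ pointsG₀ k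
  pointsG₀-complete k {y} y∈kG₀ with InDil-G₀-split {k} {y} y∈kG₀
  ... | inj₁ (j , j≤k , y∈jG)               = ∈-++⁺ˡ (belowList-complete k j≤k y∈jG)
  ... | inj₂ (j , j<k , x , x∈jG , refl) = ∈-++⁺ʳ (belowList k) (shiftedList-complete k k j<k x∈jG)

  pointsG₀-sound : ∀ k {y} → y ∈ pointsG₀ k → InDil k G₀ y
  pointsG₀-sound k {y} y∈ with ∈-++⁻ (belowList k) y∈
  ... | inj₁ y∈below with belowList-sound k y∈below
  ...   | j , j≤k , y∈jG = InDil-G⇒InDil-G₀ {k} {j} {y} j≤k y∈jG
  pointsG₀-sound k {y} y∈ | inj₂ y∈shifted with shiftedList-sound k k y∈shifted
  ...   | j , j<k , x , x∈jG , refl = InDil-G⇒InDil-G₀-shift {k} {j} {x} (ℕP.<⇒≤ j<k) x∈jG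

  EhrhartCount-G₀ : ∀ k {m} → EhrhartCount G₀ k m → m ≡ length (pointsG₀ k)
  EhrhartCount-G₀ k (ys , ys! , refl , ys≡) = unique∧set⇒length≡ ys! (pointsG₀-unique k) same
    where
    same : ∀ y → (y ∈ ys → y ∈ pointsG₀ k) × (y ∈ pointsG₀ k → y ∈ ys)
    same y = (λ y∈ys → pointsG₀-complete k (proj₁ (ys≡ y) y∈ys)) ,
             (λ y∈ → proj₂ (ys≡ y) (pointsG₀-sound k y∈))

  ehrhart₀≡cumulative : ∀ (L₀ : ℕ → ℕ) → IsEhrhartFunction G₀ L₀ →
                        ∀ k → L₀ (suc k) ≡ cumulative L (suc k) ℕ.+ cumulative L k
  ehrhart₀≡cumulative L₀ ehrhart₀ k = begin
    L₀ (suc k)                ≡⟨ EhrhartCount-G₀ (suc k) (ehrhart₀ (suc k) (s≤s z≤n)) ⟩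
    length (pointsG₀ (suc k)) ≡⟨ ListP.length-++ (belowList (suc k)) ⟩
    length (belowList (suc k)) ℕ.+ length (shiftedList (suc k) (suc k))
                              ≡⟨ cong₂ ℕ._+_ (length-belowList (suc k)) (length-shiftedList (suc k) k) ⟩
    cumulative L (suc k) ℕ.+ cumulative L k ∎

module Dimension {d n′ : ℕ} (A : Fin d → Fin (suc n′) → ℤ) (w : Fin d → ℚ) (c : ℚ)
         (onHyperplane : ∀ i → ∑ℚ (λ j → w j * toℚ (A j i)) ≡ c) (c≢0 : ¬ c ≡ 0ℚ) where

  open Levels A w c onHyperplane c≢0

  data G₀View : Fin (suc n ℕ.+ suc n) → Set where
    isU   : G₀View u
    isV   : G₀View v
    isEmb : ∀ g → G₀View (emb g)

  g₀View : ∀ i → G₀View i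
  g₀View zero    = isU
  g₀View (suc i) with splitView n (suc n) i
  ... | left a        = subst G₀View (emb-↑ˡ a) (isEmb (a ↑ˡ n))
  ... | right zero    = isV
  ... | right (suc b) = subst G₀View (emb-↑ʳ b) (isEmb (n ↑ʳ b))

  module _ {e : ℕ} (ιB : Fin (suc e) → Fin (n ℕ.+ n)) where

    B : Fin (suc e) → Fin (suc d) → ℚ
    B t = pt (G (ιB t))

    uB : Fin (suc (suc e)) → Fin (suc n ℕ.+ suc n)
    uB = u VecF.∷ (emb ∘ ιB)

    -- Ψ is -2c at u but -c on B, so u is off the affine hull of B.
    uB-indep : AffIndep G ιB → AffIndep G₀ uB
    uB-indep B-indep μ ∑μ≡0 comb≡0 = λ { zero → μ₀≡0 ; (suc i) → B-indep (μ ∘ suc) ∑μ′≡0 comb′≡0 i }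
      where
      s′ = ∑ℚ (μ ∘ suc)
      Ψ-comb : μ zero * - (c + c) + s′ * - c ≡ 0ℚ
      Ψ-comb = begin
        μ zero * - (c + c) + s′ * - c
          ≡⟨ sym (cong₂ _+_ (cong (μ zero *_) Ψ-u)
                   (trans (∑ℚ-cong (λ i → cong (μ (suc i) *_) (trans (cong (λ x → Ψ (pt x)) (G₀-emb (ιB i)))
                                                                     (Ψ-G (ιB i)))))
                          (∑ℚ-*ʳ (- c) (μ ∘ suc)))) ⟩
        ∑ℚ (λ i → μ i * Ψ (pt (G₀ (uB i))))                 ≡⟨ sym (Ψ-linear μ (λ i → pt (G₀ (uB i)))) ⟩
        Ψ (λ t → ∑ℚ (λ i → μ i * pt (G₀ (uB i)) t))         ≡⟨ Ψ-cong comb≡0 ⟩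
        Ψ (λ _ → 0ℚ)                                         ≡⟨ Ψ-0 c ⟩
        0ℚ                                                   ∎
        where
        Ψ-0 : ∀ c → ∑ℚ (λ j → w j * 0ℚ) - (c + c) * 0ℚ ≡ 0ℚ
        Ψ-0 c = trans (cong (_- (c + c) * 0ℚ) (trans (∑ℚ-cong (λ j → ℚP.*-zeroʳ (w j))) (∑ℚ-zero d)))
                      (vanish c)
          where
          vanish : ∀ c → 0ℚ - (c + c) * 0ℚ ≡ 0ℚ
          vanish = solve ringℚ
      μ₀≡0 : μ zero ≡ 0ℚ
      μ₀≡0 = *-cancelˡ-≢0 c≢0 (begin
        c * μ zero                                             ≡⟨ rewrite₁ c (μ zero) s′ ⟩
        - (μ zero * - (c + c) + s′ * - c) - c * (μ zero + s′)  ≡⟨ cong₂ (λ a b → - a - c * b) Ψ-comb ∑μ≡0 ⟩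
        - 0ℚ - c * 0ℚ                                          ≡⟨ rewrite₂ c ⟩
        c * 0ℚ                                                 ∎)
        where
        rewrite₁ : ∀ c m s → c * m ≡ - (m * - (c + c) + s * - c) - c * (m + s)
        rewrite₁ = solve ringℚ
        rewrite₂ : ∀ c → - 0ℚ - c * 0ℚ ≡ c * 0ℚ
        rewrite₂ = solve ringℚ
      drop₀ : ∀ {x} y → μ zero * x + y ≡ 0ℚ → y ≡ 0ℚ
      drop₀ {x} y eq = trans (sym (trans (cong (_+ y) (trans (cong (_* x) μ₀≡0) (ℚP.*-zeroˡ x)))
                                         (ℚP.+-identityˡ y))) eq
      ∑μ′≡0 : ∑ℚ (μ ∘ suc) ≡ 0ℚ
      ∑μ′≡0 = drop₀ {1ℚ} s′ (trans (cong (_+ s′) (ℚP.*-identityʳ (μ zero))) ∑μ≡0)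
      comb′≡0 : ∀ j → ∑ℚ (λ i → μ (suc i) * pt (G (ιB i)) j) ≡ 0ℚ
      comb′≡0 j = drop₀ (∑ℚ (λ i → μ (suc i) * pt (G (ιB i)) j))
                        (trans (cong (μ zero * pt (G₀ u) j +_)
                                     (∑ℚ-cong (λ i → cong (λ x → μ (suc i) * pt x j) (sym (G₀-emb (ιB i))))))
                               (comb≡0 j))

    uB-AffComb : (∀ g → AffComb B (pt (G g))) → ∀ i → AffComb (λ t → pt (G₀ (uB t))) (pt (G₀ i))
    uB-AffComb combs i = go (g₀View i)
      where
      cf : Fin (n ℕ.+ n) → Fin (suc e) → ℚ
      cf g = proj₁ (combs g)
      ∑cf : ∀ g → ∑ℚ (cf g) ≡ 1ℚ
      ∑cf g = proj₁ (proj₂ (combs g))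
      comb-cf : ∀ g j → ∑ℚ (λ t → cf g t * B t j) ≡ pt (G g) j
      comb-cf g j = proj₂ (proj₂ (combs g)) j
      on-B : ∀ (a : Fin (suc e) → ℚ) j → ∑ℚ (λ t → a t * pt (G₀ (emb (ιB t))) j) ≡ ∑ℚ (λ t → a t * B t j)
      on-B a j = ∑ℚ-cong (λ t → cong (λ x → a t * pt x j) (G₀-emb (ιB t)))
      go : ∀ {i} → G₀View i → AffComb (λ t → pt (G₀ (uB t))) (pt (G₀ i))
      go isU       = δ zero , ∑ℚ-δ {suc e} zero , λ j → ∑ℚ-δ-* {suc e} zero (λ t → pt (G₀ (uB t)) j)
      go (isEmb g) = 0ℚ VecF.∷ cf g , trans (ℚP.+-identityˡ _) (∑cf g) ,
                     λ j → trans (cong₂ _+_ (ℚP.*-zeroˡ (pt (G₀ u) j)) (on-B (cf g) j))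
                                 (trans (ℚP.+-identityˡ _)
                                        (trans (comb-cf g j) (cong (λ x → pt x j) (sym (G₀-emb g)))))
      go isV       = - 1ℚ VecF.∷ (λ t → cf p t + cf q t) , ∑≡1 , comb-v
        where
        ∑≡1 : - 1ℚ + ∑ℚ (λ t → cf p t + cf q t) ≡ 1ℚ
        ∑≡1 = cong (- 1ℚ +_) (trans (∑ℚ-distrib-+ (cf p) (cf q)) (cong₂ _+_ (∑cf p) (∑cf q)))
        comb-v : ∀ j → - 1ℚ * pt (G₀ u) j + ∑ℚ (λ t → (cf p t + cf q t) * pt (G₀ (emb (ιB t))) j) ≡ pt (G₀ v) j
        comb-v j = begin
          - 1ℚ * pt (G₀ u) j + ∑ℚ (λ t → (cf p t + cf q t) * pt (G₀ (emb (ιB t))) j)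
            ≡⟨ cong₂ _+_ (cong (- 1ℚ *_) (pt-u j))
                         (trans (on-B (λ t → cf p t + cf q t) j)
                                (trans (∑ℚ-cong (λ t → ℚP.*-distribʳ-+ (B t j) (cf p t) (cf q t)))
                                       (∑ℚ-distrib-+ (λ t → cf p t * B t j) (λ t → cf q t * B t j)))) ⟩
          - 1ℚ * ê₀ j + (∑ℚ (λ t → cf p t * B t j) + ∑ℚ (λ t → cf q t * B t j))
            ≡⟨ cong (λ z → - 1ℚ * ê₀ j + z) (trans (cong₂ _+_ (comb-cf p j) (comb-cf q j)) (pt-p+q j)) ⟩
          - 1ℚ * ê₀ j + ê₀ j ≡⟨ cancel (ê₀ j) ⟩
          0ℚ                 ≡⟨ sym (pt-v j) ⟩
          pt (G₀ v) j        ∎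
          where
          cancel : ∀ x → - 1ℚ * x + x ≡ 0ℚ
          cancel = solve ringℚ

  HasDim-cayley : ∀ e₀ e → HasDim G₀ e₀ → HasDim G e → e₀ ≡ suc e
  HasDim-cayley e₀ e (indep₀ , maximal₀) ((ιB , B-indep) , maximal) =
    ℕP.≤-antisym (ℕP.≤-pred (ℕP.≤-pred (AffIndep-size< G₀ indep₀ no-e+3)))
                 (ℕP.≤-pred (ℕP.≤-pred (AffIndep-size< G₀ (uB ιB , uB-indep ιB B-indep) maximal₀)))
    where
    -- A ¬¬-combination suffices since the goal is a negation.
    in-hull : ∀ g → ¬ ¬ AffComb (B ιB) (pt (G g))
    in-hull g notComb = maximal (g VecF.∷ ιB) (¬AffComb⇒AffIndep-∷ G ιB g B-indep notComb)
    no-e+3 : ∀ (ι : Fin (suc (suc (suc e))) → Fin (suc n ℕ.+ suc n)) → ¬ AffIndep G₀ ι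
    no-e+3 ι ι-indep = ¬¬-∀-Fin (n ℕ.+ n) in-hull λ combs →
      AffComb⇒¬AffIndep G₀ (λ t → pt (G₀ (uB ιB t))) ι (λ i → uB-AffComb ιB combs (ι i)) ι-indep

-- Unimodularity is used only to rule out n = 0.
corollary2p3 : (d n : ℕ) (A : Fin d → Fin n → ℤ) →
    IsConfiguration A → Unimodular A →
    (∀ i i′ → col A i ≡ col A i′ → i ≡ i′) →
    (∀ (x : Vec ℤ d) → LatPt (col₀ A) x → Σ (Fin (suc n)) (λ i → x ≡ col₀ A i)) →
    Spanning (col A) → Spanning (col₀ A) →
    (e₀ e : ℕ) (L₀ L : ℕ → ℕ) →
    HasDim (cayleyNeg (col₀ A)) e₀ → HasDim (cayleyNeg (col A)) e →
    IsEhrhartFunction (cayleyNeg (col₀ A)) L₀ → IsEhrhartFunction (cayleyNeg (col A)) L →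
    ∀ (i : ℕ) → hstar e₀ L₀ i ≡ onePlusT (hstar e L) i
corollary2p3 d zero A (_ , _ , (j , _) , _) ((σ , _) , _) _ _ _ _ _ _ _ _ _ _ _ _ _ with σ j
... | ()
corollary2p3 d (suc n′) A (w , c , _ , c≢0 , onHyperplane) _ _ latticePoints _ spanning
             e₀ e L₀ L dim₀ dim ehrhart₀ ehrhart i =
  subst (λ e′ → hstar e′ L₀ i ≡ onePlusT (hstar e L) i) (sym e₀≡1+e) (hstar-onePlusT e L₀ L L₀≡T+T i)
  where
  e₀≡1+e : e₀ ≡ suc e
  e₀≡1+e = Dimension.HasDim-cayley A w c onHyperplane c≢0 e₀ e dim₀ dim
  L₀≡T+T : ∀ k → L₀ (suc k) ≡ cumulative L (suc k) ℕ.+ cumulative L k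
  L₀≡T+T = Counting.ehrhart₀≡cumulative A w c onHyperplane c≢0 latticePoints spanning L ehrhart L₀ ehrhart₀
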